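{- Let $g$ be an integer with $g\ge 3$. The number $N_3(g)$ of numerical semigroups with multiplicity four, genus $g$ and Frobenius number congruent to $3$ modulo $4$ is: - $1$, if $g=3$; - $-\frac{21}{2}+\frac{35}{8}g-\frac38 g^2$, if $4\le g\le 5$; - $3$, if $g=6$; - $\left\lfloor\frac g5\right\rfloor^2-\left\lfloor\frac{2g}{5}\right\rfloor^2-\frac32\left\lfloor\frac{g+2}{3}\right\rfloor^2-\frac32\left\lfloor\frac{g+5}{6}\right\rfloor^2+\left\lfloor\frac g5\right\rfloor+\left(-\left\lfloor\frac g5\right\rfloor+g-1\right)\left\lfloor\frac{2g}{5}\right\rfloor+\left(\frac g2-\frac34\right)\left\lfloor\frac g2\right\rfloor+\left(g+\frac12\right)\left\lfloor\frac{g+2}{3}\right\rfloor+\left(-\left\lfloor\frac g2\right\rfloor+g+\frac12\right)\left\lfloor\frac{g+5}{6}\right\rfloor-\frac{5g^2}{8}+\frac{5g}{8}$, if $g\ge 7$.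
   Context: A numerical semigroup is a submonoid $S$ of $(\mathbb{N},+)$ with $\mathbb{N}\setminus S$ finite. Its multiplicity is its least positive element, its genus is $\#(\mathbb{N}\setminus S)$ and its Frobenius number is $\max(\mathbb{N}\setminus S)$. $\lfloor\cdot\rfloor$ is the floor function. -}

module Defs where

open import Data.Bool using (Bool; true; false; if_then_else_)
open import Data.Nat using (ℕ; zero; suc; _+_; _*_; _≤_; _<_; _%_; _/_)
open import Data.List using (List; map; upTo; length)
open import Data.Nat.ListAction using (sum)
open import Data.List.Relation.Unary.All using (All)
open import Data.List.Relation.Unary.Any using (Any)
open import Data.List.Relation.Unary.AllPairs using (AllPairs)
open import Data.Product using (Σ; _×_; ∃)
open import Relation.Binary.PropositionalEquality using (_≡_)
open import Relation.Nullary using (¬_)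
open import Data.Integer as ℤ using (ℤ; +_)

Subsetℕ : Set
Subsetℕ = ℕ → Bool

record IsNumericalSemigroup (S : Subsetℕ) : Set where
  field
    zero∈ : S 0 ≡ true
    +-closed : ∀ a b → S a ≡ true → S b ≡ true → S (a + b) ≡ true
    cofinite : ∃ λ B → ∀ n → B ≤ n → S n ≡ true

HasMultiplicity : Subsetℕ → ℕ → Set
HasMultiplicity S m = (0 < m) × (S m ≡ true) × (∀ n → 0 < n → n < m → S n ≡ false)

gapsBelow : Subsetℕ → ℕ → ℕ
gapsBelow S B = sum (map (λ n → if S n then 0 else 1) (upTo B))

HasGenus : Subsetℕ → ℕ → Set
HasGenus S g = ∃ λ B → (∀ n → B ≤ n → S n ≡ true) × gapsBelow S B ≡ g

HasFrobenius : Subsetℕ → ℕ → Set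
HasFrobenius S F = (S F ≡ false) × (∀ n → F < n → S n ≡ true)

_≐_ : Subsetℕ → Subsetℕ → Set
S ≐ T = ∀ n → S n ≡ T n

N3Prop : ℕ → Subsetℕ → Set
N3Prop g S = IsNumericalSemigroup S × HasMultiplicity S 4 × HasGenus S g
             × (∃ λ F → HasFrobenius S F × F % 4 ≡ 3)

-- "the number of subsets S with P S is N": a duplicate-free list of exactly those subsets
HasCount : (Subsetℕ → Set) → ℕ → Set
HasCount P N = Σ (List Subsetℕ) λ L →
  All P L
  × AllPairs (λ S T → ¬ (S ≐ T)) L
  × (∀ S → P S → Any (λ T → S ≐ T) L)
  × length L ≡ N

-- 8 · N₃(g) as given by the paper's formulas, as an integer
eightN3 : ℕ → ℤ
eightN3 3 = + 8
eightN3 4 = ℤ.- (+ 84) ℤ.+ (+ 35) ℤ.* (+ 4) ℤ.- (+ 3) ℤ.* (+ 16)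
eightN3 5 = ℤ.- (+ 84) ℤ.+ (+ 35) ℤ.* (+ 5) ℤ.- (+ 3) ℤ.* (+ 25)
eightN3 6 = + 24
eightN3 g =
    (+ 8) ℤ.* a ℤ.* a ℤ.- (+ 8) ℤ.* b ℤ.* b
  ℤ.- (+ 12) ℤ.* c ℤ.* c ℤ.- (+ 12) ℤ.* d ℤ.* d
  ℤ.+ (+ 8) ℤ.* a
  ℤ.+ (+ 8) ℤ.* (ℤ.- a ℤ.+ G ℤ.- + 1) ℤ.* b
  ℤ.+ ((+ 4) ℤ.* G ℤ.- + 6) ℤ.* e
  ℤ.+ ((+ 8) ℤ.* G ℤ.+ + 4) ℤ.* c
  ℤ.+ ((+ 8) ℤ.* (ℤ.- e ℤ.+ G) ℤ.+ + 4) ℤ.* d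
  ℤ.- (+ 5) ℤ.* G ℤ.* G ℤ.+ (+ 5) ℤ.* G
  where
    G = + g
    a = + (g / 5)
    b = + ((2 * g) / 5)
    c = + ((g + 2) / 3)
    d = + ((g + 5) / 6)
    e = + (g / 2)

module Submission where

-- A semigroup S of multiplicity 4 is determined by the
--    numbers k₁, k₂, k₃ with 4kᵣ + r the least element of S in the class r
--    (mod 4).  Its genus is k₁ + k₂ + k₃, and its Frobenius number is ≡ 3
--    (mod 4) exactly when k₃ is the largest coordinate.  Writing a = k₁,
--    d = k₃ − k₁ and k₂ = g − 2a − d, these semigroups of genus g correspond
--    bijectively to the lattice points (a, d) of a polygon `Admissible g`;
--    an explicit duplicate-free list of them gives `HasCount (N3Prop g) (N g)`
--    where N g counts the admissible points.
--  * Counting.  Translating the polygon by (1,1) embeds the points for g into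
--    those for g + 5, missing only three boundary edges whose point counts
--    have closed forms in ⌊·/2⌋, ⌊·/3⌋.  These are quasi-periodic with period
--    30, which yields N(g + 60) + N(g) = 2·N(g + 30) + 60.
--  * The paper's closed formula obeys the same second-order recurrence (a
--    polynomial identity after shifting the floors), so 8·N(g) = eightN3 g
--    follows by induction from the values 3 ≤ g < 67, checked by evaluation.

module FiniteSums where

  open import Data.Bool using (Bool; true; false)
  open import Data.Nat
  open import Data.Nat.Properties
  open import Data.Nat.ListAction using (sum)
  open import Data.List using (map; upTo; applyUpTo)
  open import Data.Product using (_,_; proj₁; proj₂)
  open import Data.Sum using (_⊎_; inj₁; inj₂)
  open import Function using (_∘_)
  open import Relation.Nullary using (Dec; yes; no; does; ¬_)
  open import Relation.Nullary.Decidable using (_×-dec_; dec-true; dec-false)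
  open import Relation.Binary.PropositionalEquality
  import Data.Nat.Tactic.RingSolver as ℕ-Ring
  open import Algebra.Properties.CommutativeSemigroup +-commutativeSemigroup using () renaming (interchange to +-interchange)

  private variable
    P Q : Set

  bit : Bool → ℕ
  bit true = 1
  bit false = 0

  𝟙 : Dec P → ℕ
  𝟙 P? = bit (does P?)

  𝟙-yes : (P? : Dec P) → P → 𝟙 P? ≡ 1
  𝟙-yes P? p = cong bit (dec-true P? p)

  𝟙-no : (P? : Dec P) → ¬ P → 𝟙 P? ≡ 0
  𝟙-no P? ¬p = cong bit (dec-false P? ¬p)

  does-⇔ : (P? : Dec P) (Q? : Dec Q) → (P → Q) → (Q → P) → does P? ≡ does Q?
  does-⇔ (yes p)  Q? to from = sym (dec-true Q? (to p))
  does-⇔ (no ¬p) Q? to from = sym (dec-false Q? (¬p ∘ from))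

  𝟙-⇔ : (P? : Dec P) (Q? : Dec Q) → (P → Q) → (Q → P) → 𝟙 P? ≡ 𝟙 Q?
  𝟙-⇔ P? Q? to from = cong bit (does-⇔ P? Q? to from)

  𝟙-partition : ∀ {P Q A B C : Set} (P? : Dec P) (Q? : Dec Q) (A? : Dec A) (B? : Dec B) (C? : Dec C) →
    (Q → P) → (A → P) → (B → P) → (C → P) → (P → ¬ Q → A ⊎ B ⊎ C) →
    (A → ¬ Q) → (B → ¬ Q) → (C → ¬ Q) → (A → ¬ B) → (A → ¬ C) → (B → ¬ C) →
    𝟙 P? ≡ 𝟙 Q? + 𝟙 A? + 𝟙 B? + 𝟙 C?
  𝟙-partition P? (yes q) A? B? C? q⇒p _ _ _ _ a⇒¬q b⇒¬q c⇒¬q _ _ _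
    rewrite 𝟙-yes P? (q⇒p q) | 𝟙-no A? (λ a → a⇒¬q a q) | 𝟙-no B? (λ b → b⇒¬q b q) | 𝟙-no C? (λ c → c⇒¬q c q) = refl
  𝟙-partition (no ¬p) (no ¬q) A? B? C? _ a⇒p b⇒p c⇒p _ _ _ _ _ _ _
    rewrite 𝟙-no A? (¬p ∘ a⇒p) | 𝟙-no B? (¬p ∘ b⇒p) | 𝟙-no C? (¬p ∘ c⇒p) = refl
  𝟙-partition (yes p) (no ¬q) A? B? C? _ _ _ _ cover _ _ _ a⇒¬b a⇒¬c b⇒¬c with cover p ¬q
  ... | inj₁ a        rewrite 𝟙-yes A? a | 𝟙-no B? (a⇒¬b a) | 𝟙-no C? (a⇒¬c a) = refl
  ... | inj₂ (inj₁ b) rewrite 𝟙-no A? (λ a → a⇒¬b a b) | 𝟙-yes B? b | 𝟙-no C? (b⇒¬c b) = refl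
  ... | inj₂ (inj₂ c) rewrite 𝟙-no A? (λ a → a⇒¬c a c) | 𝟙-no B? (λ b → b⇒¬c b c) | 𝟙-yes C? c = refl

  sumBelow : ℕ → (ℕ → ℕ) → ℕ
  sumBelow zero    f = 0
  sumBelow (suc n) f = sumBelow n f + f n

  sumBelow-cong : ∀ n {f g : ℕ → ℕ} → (∀ x → x < n → f x ≡ g x) → sumBelow n f ≡ sumBelow n g
  sumBelow-cong zero    eq = refl
  sumBelow-cong (suc n) eq =
    cong₂ _+_ (sumBelow-cong n (λ x x<n → eq x (m<n⇒m<1+n x<n))) (eq n ≤-refl)

  sumBelow-+ : ∀ n (f g : ℕ → ℕ) → sumBelow n (λ x → f x + g x) ≡ sumBelow n f + sumBelow n g
  sumBelow-+ zero    f g = refl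
  sumBelow-+ (suc n) f g =
    trans (cong (_+ (f n + g n)) (sumBelow-+ n f g)) (+-interchange (sumBelow n f) (sumBelow n g) (f n) (g n))

  sumBelow-zero : ∀ n (f : ℕ → ℕ) → (∀ x → x < n → f x ≡ 0) → sumBelow n f ≡ 0
  sumBelow-zero zero    f vanish = refl
  sumBelow-zero (suc n) f vanish =
    cong₂ _+_ (sumBelow-zero n f (λ x x<n → vanish x (m<n⇒m<1+n x<n))) (vanish n ≤-refl)

  sumBelow-first : ∀ n (f : ℕ → ℕ) → sumBelow (suc n) f ≡ f 0 + sumBelow n (f ∘ suc)
  sumBelow-first zero    f = +-comm 0 (f 0)
  sumBelow-first (suc n) f =
    trans (cong (_+ f (suc n)) (sumBelow-first n f)) (+-assoc (f 0) (sumBelow n (f ∘ suc)) (f (suc n)))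

  sumBelow-extend : ∀ {n} m (f : ℕ → ℕ) → n ≤ m → (∀ x → n ≤ x → f x ≡ 0) → sumBelow m f ≡ sumBelow n f
  sumBelow-extend m f n≤m vanish with m≤n⇒m<n∨m≡n n≤m
  ... | inj₂ refl = refl
  sumBelow-extend (suc m) f _ vanish | inj₁ (s≤s n≤m) =
    trans (cong (sumBelow m f +_) (vanish m n≤m))
          (trans (+-identityʳ _) (sumBelow-extend m f n≤m vanish))

  sumBelow-single : ∀ n t (f : ℕ → ℕ) → t < n → (∀ x → x ≢ t → f x ≡ 0) → sumBelow n f ≡ f t
  sumBelow-single (suc n) t f t<1+n vanish with m≤n⇒m<n∨m≡n (≤-pred t<1+n)
  ... | inj₁ t<n  = trans (cong₂ _+_ (sumBelow-single n t f t<n vanish) (vanish n (>⇒≢ t<n)))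
                          (+-identityʳ (f t))
  ... | inj₂ refl = cong (_+ f n) (sumBelow-zero n f (λ x x<n → vanish x (<⇒≢ x<n)))

  count-unique : ∀ {Q : ℕ → Set} (Q? : ∀ x → Dec (Q x)) t n →
                 (∀ x → Q x → x ≡ t) → t < n → sumBelow n (𝟙 ∘ Q?) ≡ 𝟙 (Q? t)
  count-unique Q? t n only-t t<n =
    sumBelow-single n t (𝟙 ∘ Q?) t<n (λ x x≢t → 𝟙-no (Q? x) (x≢t ∘ only-t x))

  count-none : ∀ {Q : ℕ → Set} (Q? : ∀ x → Dec (Q x)) n → (∀ x → ¬ Q x) → sumBelow n (𝟙 ∘ Q?) ≡ 0
  count-none Q? n none = sumBelow-zero n (𝟙 ∘ Q?) (λ x _ → 𝟙-no (Q? x) (none x))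

  count-atLeast : ∀ lo n → sumBelow n (λ x → 𝟙 (lo ≤? x)) ≡ n ∸ lo
  count-atLeast lo zero    = sym (0∸n≡0 lo)
  count-atLeast lo (suc n) = trans (cong (_+ 𝟙 (lo ≤? n)) (count-atLeast lo n)) (step (lo ≤? n))
    where
    step : (lo≤?n : Dec (lo ≤ n)) → n ∸ lo + 𝟙 lo≤?n ≡ suc n ∸ lo
    step (yes lo≤n) = trans (+-comm (n ∸ lo) 1) (sym (+-∸-assoc 1 lo≤n))
    step (no lo≰n)  = trans (+-identityʳ _)
                            (trans (m≤n⇒m∸n≡0 (≰⇒≥ lo≰n)) (sym (m≤n⇒m∸n≡0 (≰⇒> lo≰n))))

  count-interval : ∀ lo hi n → hi < n → sumBelow n (λ x → 𝟙 ((lo ≤? x) ×-dec (x ≤? hi))) ≡ suc hi ∸ lo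
  count-interval lo hi n hi<n =
    begin
      sumBelow n (λ x → 𝟙 ((lo ≤? x) ×-dec (x ≤? hi)))
        ≡⟨ sumBelow-extend n _ hi<n (λ x hi<x → 𝟙-no ((lo ≤? x) ×-dec (x ≤? hi)) (<⇒≱ hi<x ∘ proj₂)) ⟩
      sumBelow (suc hi) (λ x → 𝟙 ((lo ≤? x) ×-dec (x ≤? hi)))
        ≡⟨ sumBelow-cong (suc hi) (λ x x≤hi →
             𝟙-⇔ ((lo ≤? x) ×-dec (x ≤? hi)) (lo ≤? x) proj₁ (_, ≤-pred x≤hi)) ⟩
      sumBelow (suc hi) (λ x → 𝟙 (lo ≤? x))
        ≡⟨ count-atLeast lo (suc hi) ⟩
      suc hi ∸ lo ∎
    where open ≡-Reasoning

  sumBelow-blocks4 : ∀ (f : ℕ → ℕ) Q →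
    sumBelow (4 * Q) f ≡ sumBelow Q (λ q → f (4 * q) + f (1 + 4 * q) + f (2 + 4 * q) + f (3 + 4 * q))
  sumBelow-blocks4 f zero    = refl
  sumBelow-blocks4 f (suc Q) =
    begin
      sumBelow (4 * suc Q) f
        ≡⟨ cong (λ n → sumBelow n f) (*-suc 4 Q) ⟩
      sumBelow (4 * Q) f + f (4 * Q) + f (1 + 4 * Q) + f (2 + 4 * Q) + f (3 + 4 * Q)
        ≡⟨ regroup (sumBelow (4 * Q) f) (f (4 * Q)) (f (1 + 4 * Q)) (f (2 + 4 * Q)) (f (3 + 4 * Q)) ⟩
      sumBelow (4 * Q) f + (f (4 * Q) + f (1 + 4 * Q) + f (2 + 4 * Q) + f (3 + 4 * Q))
        ≡⟨ cong (_+ (f (4 * Q) + f (1 + 4 * Q) + f (2 + 4 * Q) + f (3 + 4 * Q))) (sumBelow-blocks4 f Q) ⟩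
      sumBelow (suc Q) (λ q → f (4 * q) + f (1 + 4 * q) + f (2 + 4 * q) + f (3 + 4 * q)) ∎
    where
    open ≡-Reasoning
    regroup : ∀ s a b c d → s + a + b + c + d ≡ s + (a + b + c + d)
    regroup = ℕ-Ring.solve-∀

  sum-upTo : ∀ n (f : ℕ → ℕ) → sum (map f (upTo n)) ≡ sumBelow n f
  sum-upTo n f = sum-applyUpTo n (λ x → x)
    where
    sum-applyUpTo : ∀ n (h : ℕ → ℕ) → sum (map f (applyUpTo h n)) ≡ sumBelow n (f ∘ h)
    sum-applyUpTo zero    h = refl
    sum-applyUpTo (suc n) h =
      trans (cong (f (h 0) +_) (sum-applyUpTo n (h ∘ suc))) (sym (sumBelow-first n (f ∘ h)))

  sumSquare : ℕ → (ℕ → ℕ → ℕ) → ℕ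
  sumSquare M f = sumBelow M (λ a → sumBelow M (f a))

  sumSquare-+ : ∀ M (f g : ℕ → ℕ → ℕ) → sumSquare M (λ a d → f a d + g a d) ≡ sumSquare M f + sumSquare M g
  sumSquare-+ M f g = trans (sumBelow-cong M (λ a _ → sumBelow-+ M (f a) (g a))) (sumBelow-+ M _ _)

  sumSquare-cong : ∀ M {f g : ℕ → ℕ → ℕ} → (∀ a d → f a d ≡ g a d) → sumSquare M f ≡ sumSquare M g
  sumSquare-cong M eq = sumBelow-cong M (λ a _ → sumBelow-cong M (λ d _ → eq a d))

module FloorDivision where

  open import Data.Nat
  open import Data.Nat.Properties
  open import Data.Nat.DivMod
  open import Data.Nat.Divisibility using (divides)
  open import Relation.Binary.PropositionalEquality

  *≤⇒≤/ : ∀ k a x .{{_ : NonZero k}} → k * a ≤ x → a ≤ x / k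
  *≤⇒≤/ k a x ka≤x = subst (_≤ x / k) (m*n/n≡m a k) (/-monoˡ-≤ k (subst (_≤ x) (*-comm k a) ka≤x))

  ≤/⇒*≤ : ∀ k a x .{{_ : NonZero k}} → a ≤ x / k → k * a ≤ x
  ≤/⇒*≤ k a x a≤x/k = ≤-trans (*-monoʳ-≤ k a≤x/k) (subst (_≤ x) (*-comm (x / k) k) (m/n*n≤m x k))

  <*⇒/< : ∀ k a x .{{_ : NonZero k}} → x < k * a → x / k < a
  <*⇒/< k a x x<ka = ≰⇒> (λ a≤x/k → <⇒≱ x<ka (≤/⇒*≤ k a x a≤x/k))

  /<⇒<* : ∀ k a x .{{_ : NonZero k}} → x / k < a → x < k * a
  /<⇒<* k a x x/k<a = ≰⇒> (λ ka≤x → <⇒≱ x/k<a (*≤⇒≤/ k a x ka≤x))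

  /-shift : ∀ m k d .{{_ : NonZero d}} → (m + k * d) / d ≡ m / d + k
  /-shift m k d = trans (+-distrib-/-∣ʳ m (divides k refl)) (cong (m / d +_) (m*n/n≡m k d))

-- Such a semigroup S is determined by k₁, k₂, k₃, where 4·kᵣ + r is the least
-- element of S congruent to r mod 4 (its Apéry element); its gaps are the
-- numbers r + 4q with q < kᵣ, so its genus is k₁ + k₂ + k₃.
module KunzCoordinates where

  open import Defs using (Subsetℕ; IsNumericalSemigroup; HasMultiplicity; HasGenus; HasFrobenius; gapsBelow; _≐_; N3Prop)
  open import Data.Bool using (Bool; true; false; T; if_then_else_)
  open import Data.Unit using (tt)
  open import Data.Nat
  open import Data.Nat.Properties
  open import Data.Nat.DivMod
  open import Data.Product using (∃; _×_; _,_; proj₁; proj₂)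
  open import Data.Sum using (inj₁; inj₂)
  open import Data.Empty using (⊥-elim)
  open import Function using (_∘_)
  open import Relation.Nullary using (yes; no; ¬_)
  open import Relation.Nullary.Decidable using (dec-true; dec-false)
  open import Relation.Binary.PropositionalEquality
  import Data.Nat.Tactic.RingSolver as ℕ-Ring
  open FiniteSums
  open FloorDivision

  private variable
    m n : ℕ

  ≤ᵇ-true : m ≤ n → (m ≤ᵇ n) ≡ true
  ≤ᵇ-true {m} {n} = dec-true (m ≤? n)

  ≤ᵇ-false : ¬ m ≤ n → (m ≤ᵇ n) ≡ false
  ≤ᵇ-false {m} {n} = dec-false (m ≤? n)

  ≤ᵇ-sound : (m ≤ᵇ n) ≡ true → m ≤ n
  ≤ᵇ-sound {m} {n} e = ≤ᵇ⇒≤ m n (subst T (sym e) tt)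

  residue-split : ∀ n → n ≡ n % 4 + 4 * (n / 4)
  residue-split n = trans (m≡m%n+[m/n]*n n 4) (cong (n % 4 +_) (*-comm (n / 4) 4))

  residue-of : ∀ r q → r < 4 → (r + 4 * q) % 4 ≡ r
  residue-of r q r<4 =
    trans (cong (λ x → (r + x) % 4) (*-comm 4 q)) (trans ([m+kn]%n≡m%n r q 4) (m<n⇒m%n≡m r<4))

  gapBit : Bool → ℕ
  gapBit b = if b then 0 else 1

  gap : Subsetℕ → ℕ → ℕ
  gap S n = gapBit (S n)

  gapsBelow-≐ : ∀ {S T : Subsetℕ} {B C : ℕ} → S ≐ T →
                (∀ n → B ≤ n → S n ≡ true) → (∀ n → C ≤ n → T n ≡ true) →
                gapsBelow S B ≡ gapsBelow T C
  gapsBelow-≐ {S} {T} {B} {C} S≐T S-beyond T-beyond =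
    begin
      gapsBelow S B         ≡⟨ sum-upTo B (gap S) ⟩
      sumBelow B (gap S)    ≡⟨ sumBelow-extend (B + C) (gap S) (m≤m+n B C) (λ n B≤n → cong gapBit (S-beyond n B≤n)) ⟨
      sumBelow (B + C) (gap S) ≡⟨ sumBelow-cong (B + C) (λ n _ → cong gapBit (S≐T n)) ⟩
      sumBelow (B + C) (gap T) ≡⟨ sumBelow-extend (B + C) (gap T) (m≤n+m C B) (λ n C≤n → cong gapBit (T-beyond n C≤n)) ⟩
      sumBelow C (gap T)    ≡⟨ sum-upTo C (gap T) ⟨
      gapsBelow T C ∎
    where open ≡-Reasoning

  kunz : ℕ → ℕ → ℕ → ℕ → ℕ
  kunz k₁ k₂ k₃ 1 = k₁
  kunz k₁ k₂ k₃ 2 = k₂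
  kunz k₁ k₂ k₃ 3 = k₃
  kunz k₁ k₂ k₃ _ = 0

  -- n belongs to the semigroup with coordinates k₁, k₂, k₃ iff it is at least the
  -- Apéry element 4·k_{n mod 4} + n mod 4 of its residue class.
  semigroupOf : ℕ → ℕ → ℕ → Subsetℕ
  semigroupOf k₁ k₂ k₃ n = 4 * kunz k₁ k₂ k₃ (n % 4) + n % 4 ≤ᵇ n

  semigroupOf-member : ∀ k₁ k₂ k₃ r q → r < 4 → semigroupOf k₁ k₂ k₃ (r + 4 * q) ≡ (kunz k₁ k₂ k₃ r ≤ᵇ q)
  semigroupOf-member k₁ k₂ k₃ r q r<4 rewrite residue-of r q r<4 =
    does-⇔ (4 * k + r ≤? r + 4 * q) (k ≤? q)
      (λ le → *-cancelˡ-≤ 4 (+-cancelʳ-≤ r _ _ (subst (4 * k + r ≤_) (+-comm r (4 * q)) le)))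
      (λ le → subst (4 * k + r ≤_) (+-comm (4 * q) r) (+-monoˡ-≤ r (*-monoʳ-≤ 4 le)))
    where k = kunz k₁ k₂ k₃ r

  -- The Kunz inequalities for multiplicity 4, together with k₁, k₂ ≤ k₃ (the largest
  -- Apéry element lies in the class of 3, i.e. the Frobenius number is ≡ 3 mod 4).
  -- The remaining Kunz inequalities 2k₃ + 1 ≥ k₂ and k₂ + k₃ + 1 ≥ k₁ follow.
  record Kunz (k₁ k₂ k₃ : ℕ) : Set where
    field
      k₁≥1 : 1 ≤ k₁
      k₂≥1 : 1 ≤ k₂
      k₁≤k₃ : k₁ ≤ k₃
      k₂≤k₃ : k₂ ≤ k₃
      k₂≤2k₁ : k₂ ≤ 2 * k₁
      k₃≤k₁+k₂ : k₃ ≤ k₁ + k₂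

  below : ℕ → ℕ → ℕ
  below k q = gapBit (k ≤ᵇ q)

  count-below : ∀ k Q → k ≤ Q → sumBelow Q (below k) ≡ k
  count-below k Q k≤Q =
    trans (sumBelow-extend Q (below k) k≤Q (λ q k≤q → cong gapBit (≤ᵇ-true k≤q)))
          (all-below k ≤-refl)
    where
    all-below : ∀ Q → Q ≤ k → sumBelow Q (below k) ≡ Q
    all-below zero    _   = refl
    all-below (suc Q) Q<k =
      trans (cong₂ _+_ (all-below Q (<⇒≤ Q<k)) (cong gapBit (≤ᵇ-false (<⇒≱ Q<k))))
            (+-comm Q 1)

  0<4 : 0 < 4
  0<4 = s≤s z≤n
  1<4 : 1 < 4
  1<4 = s≤s (s≤s z≤n)
  2<4 : 2 < 4
  2<4 = s≤s (s≤s (s≤s z≤n))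
  3<4 : 3 < 4
  3<4 = s≤s (s≤s (s≤s (s≤s z≤n)))

  module FromCoordinates {k₁ k₂ k₃ : ℕ} (K : Kunz k₁ k₂ k₃) where
    open Kunz K

    S : Subsetℕ
    S = semigroupOf k₁ k₂ k₃

    apery : ℕ → ℕ
    apery r = 4 * kunz k₁ k₂ k₃ r + r

    mono4 : ∀ {x y} c → x ≤ y → 4 * x + c ≤ 4 * y + c
    mono4 c p = +-monoˡ-≤ c (*-monoʳ-≤ 4 p)

    -- The Kunz inequalities say exactly that Apéry elements are subadditive.
    apery-subadditive : ∀ r s → r < 4 → s < 4 → apery ((r + s) % 4) ≤ apery r + apery s
    apery-subadditive 0 s _ s<4 rewrite m<n⇒m%n≡m s<4 = ≤-refl
    apery-subadditive 1 0 _ _ = m≤m+n (apery 1) 0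
    apery-subadditive 2 0 _ _ = m≤m+n (apery 2) 0
    apery-subadditive 3 0 _ _ = m≤m+n (apery 3) 0
    apery-subadditive 1 1 _ _ = subst (apery 2 ≤_) (sym (e₁₁ k₁)) (mono4 2 k₂≤2k₁)
      where e₁₁ : ∀ a → (4 * a + 1) + (4 * a + 1) ≡ 4 * (2 * a) + 2
            e₁₁ = ℕ-Ring.solve-∀
    apery-subadditive 1 2 _ _ = subst (apery 3 ≤_) (sym (e₁₂ k₁ k₂)) (mono4 3 k₃≤k₁+k₂)
      where e₁₂ : ∀ a b → (4 * a + 1) + (4 * b + 2) ≡ 4 * (a + b) + 3
            e₁₂ = ℕ-Ring.solve-∀
    apery-subadditive 1 3 _ _ = z≤n
    apery-subadditive 2 1 _ _ = subst (apery 3 ≤_) (sym (e₂₁ k₁ k₂)) (mono4 3 k₃≤k₁+k₂)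
      where e₂₁ : ∀ a b → (4 * b + 2) + (4 * a + 1) ≡ 4 * (a + b) + 3
            e₂₁ = ℕ-Ring.solve-∀
    apery-subadditive 2 2 _ _ = z≤n
    apery-subadditive 2 3 _ _ = subst (apery 1 ≤_) (sym (e₂₃ k₂ k₃)) (≤-trans (mono4 1 k₁≤k₃) (m≤m+n _ _))
      where e₂₃ : ∀ b c → (4 * b + 2) + (4 * c + 3) ≡ (4 * c + 1) + (4 * b + 4)
            e₂₃ = ℕ-Ring.solve-∀
    apery-subadditive 3 1 _ _ = z≤n
    apery-subadditive 3 2 _ _ = subst (apery 1 ≤_) (sym (e₃₂ k₂ k₃)) (≤-trans (mono4 1 k₁≤k₃) (m≤m+n _ _))
      where e₃₂ : ∀ b c → (4 * c + 3) + (4 * b + 2) ≡ (4 * c + 1) + (4 * b + 4)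
            e₃₂ = ℕ-Ring.solve-∀
    apery-subadditive 3 3 _ _ = subst (apery 2 ≤_) (sym (e₃₃ k₃)) (≤-trans (mono4 2 k₂≤k₃) (m≤m+n _ _))
      where e₃₃ : ∀ c → (4 * c + 3) + (4 * c + 3) ≡ (4 * c + 2) + (4 * c + 4)
            e₃₃ = ℕ-Ring.solve-∀
    apery-subadditive (suc (suc (suc (suc _)))) _ (s≤s (s≤s (s≤s (s≤s ())))) _
    apery-subadditive 1 (suc (suc (suc (suc _)))) _ (s≤s (s≤s (s≤s (s≤s ()))))
    apery-subadditive 2 (suc (suc (suc (suc _)))) _ (s≤s (s≤s (s≤s (s≤s ()))))
    apery-subadditive 3 (suc (suc (suc (suc _)))) _ (s≤s (s≤s (s≤s (s≤s ()))))

    +-closed : ∀ a b → S a ≡ true → S b ≡ true → S (a + b) ≡ true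
    +-closed a b a∈S b∈S = ≤ᵇ-true (subst (λ t → apery t ≤ a + b) (sym (%-distribˡ-+ a b 4))
      (≤-trans (apery-subadditive (a % 4) (b % 4) (m%n<n a 4) (m%n<n b 4))
               (+-mono-≤ (≤ᵇ-sound {apery (a % 4)} {a} a∈S) (≤ᵇ-sound {apery (b % 4)} {b} b∈S))))

    kunz≤k₃ : ∀ r → r < 4 → kunz k₁ k₂ k₃ r ≤ k₃
    kunz≤k₃ 0 _ = z≤n
    kunz≤k₃ 1 _ = k₁≤k₃
    kunz≤k₃ 2 _ = k₂≤k₃
    kunz≤k₃ 3 _ = ≤-refl
    kunz≤k₃ (suc (suc (suc (suc _)))) (s≤s (s≤s (s≤s (s≤s ()))))

    -- Every n ≥ 4k₃ is in S: its level ⌊n/4⌋ reaches the coordinate of its class.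
    beyond-conductor : ∀ n → 4 * k₃ ≤ n → S n ≡ true
    beyond-conductor n 4k₃≤n =
      trans (cong S (residue-split n))
            (trans (semigroupOf-member k₁ k₂ k₃ (n % 4) (n / 4) (m%n<n n 4))
                   (≤ᵇ-true (≤-trans (kunz≤k₃ (n % 4) (m%n<n n 4)) (*≤⇒≤/ 4 k₃ n 4k₃≤n))))

    isNumericalSemigroup : IsNumericalSemigroup S
    isNumericalSemigroup = record
      { zero∈ = refl ; +-closed = +-closed ; cofinite = 4 * k₃ , beyond-conductor }

    -- 1, 2, 3 ∉ S because their coordinates are positive.
    multiplicity : HasMultiplicity S 4
    multiplicity = 0<4 , refl , small-gap
      where
      not-apery : ∀ {k} r → 1 ≤ k → (4 * k + r ≤ᵇ r) ≡ false
      not-apery {k} r 1≤k = ≤ᵇ-false (<⇒≱ (m<n+m r (≤-trans 0<4 (*-monoʳ-≤ 4 1≤k))))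
      small-gap : ∀ n → 0 < n → n < 4 → S n ≡ false
      small-gap 1 _ _ = not-apery 1 k₁≥1
      small-gap 2 _ _ = not-apery 2 k₂≥1
      small-gap 3 _ _ = not-apery 3 (≤-trans k₁≥1 k₁≤k₃)
      small-gap (suc (suc (suc (suc _)))) _ (s≤s (s≤s (s≤s (s≤s ()))))

    -- The Frobenius number is 4k₃ − 1 = 3 + 4(k₃ − 1).
    frobenius : ∃ λ F → HasFrobenius S F × F % 4 ≡ 3
    frobenius = F , (F∉S , beyond-F) , residue-of 3 j 3<4
      where
      j : ℕ
      j = k₃ ∸ 1
      1+j≡k₃ : suc j ≡ k₃
      1+j≡k₃ = trans (+-comm 1 j) (m∸n+n≡m (≤-trans k₁≥1 k₁≤k₃))
      F : ℕ
      F = 3 + 4 * j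
      F∉S : S F ≡ false
      F∉S = trans (semigroupOf-member k₁ k₂ k₃ 3 j 3<4)
                  (≤ᵇ-false (λ k₃≤j → <-irrefl refl (subst (_≤ j) (sym 1+j≡k₃) k₃≤j)))
      beyond-F : ∀ n → F < n → S n ≡ true
      beyond-F n F<n = beyond-conductor n (subst (_≤ n) (trans (sym (*-suc 4 j)) (cong (4 *_) 1+j≡k₃)) F<n)

    -- The gaps are r + 4q with q < kᵣ, so there are k₁ + k₂ + k₃ of them.
    genus : gapsBelow S (4 * k₃) ≡ k₁ + k₂ + k₃
    genus = begin
        gapsBelow S (4 * k₃)
      ≡⟨ sum-upTo (4 * k₃) (gap S) ⟩
        sumBelow (4 * k₃) (gap S)
      ≡⟨ sumBelow-blocks4 (gap S) k₃ ⟩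
        sumBelow k₃ (λ q → gap S (4 * q) + gap S (1 + 4 * q) + gap S (2 + 4 * q) + gap S (3 + 4 * q))
      ≡⟨ sumBelow-cong k₃ (λ q _ → cong₂ _+_ (cong₂ _+_ (cong₂ _+_
           (level 0 q 0<4) (level 1 q 1<4)) (level 2 q 2<4)) (level 3 q 3<4)) ⟩
        sumBelow k₃ (λ q → below 0 q + below k₁ q + below k₂ q + below k₃ q)
      ≡⟨ sumBelow-+ k₃ (λ q → below 0 q + below k₁ q + below k₂ q) (below k₃) ⟩
        sumBelow k₃ (λ q → below 0 q + below k₁ q + below k₂ q) + sumBelow k₃ (below k₃)
      ≡⟨ cong (_+ sumBelow k₃ (below k₃))
           (trans (sumBelow-+ k₃ (λ q → below 0 q + below k₁ q) (below k₂))
                  (cong (_+ sumBelow k₃ (below k₂)) (sumBelow-+ k₃ (below 0) (below k₁)))) ⟩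
        sumBelow k₃ (below 0) + sumBelow k₃ (below k₁) + sumBelow k₃ (below k₂) + sumBelow k₃ (below k₃)
      ≡⟨ cong₂ _+_ (cong₂ _+_ (cong₂ _+_ (count-below 0 k₃ z≤n) (count-below k₁ k₃ k₁≤k₃))
                              (count-below k₂ k₃ k₂≤k₃)) (count-below k₃ k₃ ≤-refl) ⟩
        k₁ + k₂ + k₃ ∎
      where
      open ≡-Reasoning
      level : ∀ r q → r < 4 → gap S (r + 4 * q) ≡ below (kunz k₁ k₂ k₃ r) q
      level r q r<4 = cong gapBit (semigroupOf-member k₁ k₂ k₃ r q r<4)

    isN3 : N3Prop (k₁ + k₂ + k₃) S
    isN3 = isNumericalSemigroup , multiplicity , (4 * k₃ , beyond-conductor , genus) , frobenius

  true≢false : true ≢ false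
  true≢false ()

  -- least p b is the least q with p q ≡ true, provided p b ≡ true.
  least : (ℕ → Bool) → ℕ → ℕ
  least p zero    = 0
  least p (suc b) with p 0
  ... | true  = 0
  ... | false = suc (least (p ∘ suc) b)

  least-satisfies : ∀ (p : ℕ → Bool) b → p b ≡ true → p (least p b) ≡ true
  least-satisfies p zero    pb = pb
  least-satisfies p (suc b) pb with p 0 in p0
  ... | true  = p0
  ... | false = least-satisfies (p ∘ suc) b pb

  least-minimal : ∀ (p : ℕ → Bool) b q → q < least p b → p q ≡ false
  least-minimal p (suc b) q q<least with p 0 in p0
  least-minimal p (suc b) zero    _     | false = p0
  least-minimal p (suc b) (suc q) q<least | false = least-minimal (p ∘ suc) b q (≤-pred q<least)

  least-threshold : ∀ (p : ℕ → Bool) b → p b ≡ true → (∀ q → p q ≡ true → p (suc q) ≡ true) →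
                    ∀ q → p q ≡ (least p b ≤ᵇ q)
  least-threshold p b pb up q with least p b ≤? q
  ... | yes least≤q = trans (upward q least≤q) (sym (≤ᵇ-true least≤q))
    where
    upward : ∀ q → least p b ≤ q → p q ≡ true
    upward q least≤q with m≤n⇒m<n∨m≡n least≤q
    ... | inj₂ refl = least-satisfies p b pb
    upward (suc q) _ | inj₁ (s≤s least≤q) = up q (upward q least≤q)
  ... | no least≰q  = trans (least-minimal p b q (≰⇒> least≰q)) (sym (≤ᵇ-false least≰q))

  -- Conversely, every semigroup counted by N3Prop g is given by its Kunz coordinates
  -- kᵣ = min {q | r + 4q ∈ S}, which satisfy the Kunz conditions and sum to g.
  module ToCoordinates {g : ℕ} {S : Subsetℕ} (isN3 : N3Prop g S) where
    private
      open IsNumericalSemigroup (proj₁ isN3)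
      bound : ℕ
      bound = proj₁ cofinite
      4∈S : S 4 ≡ true
      4∈S = proj₁ (proj₂ (proj₁ (proj₂ isN3)))
      small-gap : ∀ n → 0 < n → n < 4 → S n ≡ false
      small-gap = proj₂ (proj₂ (proj₁ (proj₂ isN3)))
      genus : HasGenus S g
      genus = proj₁ (proj₂ (proj₂ isN3))
      frob : ∃ λ F → HasFrobenius S F × F % 4 ≡ 3
      frob = proj₂ (proj₂ (proj₂ isN3))
      F : ℕ
      F = proj₁ frob
      F∉S : S F ≡ false
      F∉S = proj₁ (proj₁ (proj₂ frob))
      beyond-F : ∀ n → F < n → S n ≡ true
      beyond-F = proj₂ (proj₁ (proj₂ frob))
      F%4 : F % 4 ≡ 3
      F%4 = proj₂ (proj₂ frob)

    inClass : ℕ → ℕ → Bool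
    inClass r q = S (r + 4 * q)

    coord : ℕ → ℕ
    coord r = least (inClass r) bound

    k₁ k₂ k₃ : ℕ
    k₁ = coord 1
    k₂ = coord 2
    k₃ = coord 3

    -- Membership in a class is a threshold condition, since S + 4 ⊆ S.
    inClass-threshold : ∀ r q → inClass r q ≡ (coord r ≤ᵇ q)
    inClass-threshold r = least-threshold (inClass r) bound
      (proj₂ cofinite (r + 4 * bound) (≤-trans (m≤n*m bound 4) (m≤n+m (4 * bound) r)))
      (λ q rq∈S → trans (cong S (shift r q)) (+-closed (r + 4 * q) 4 rq∈S 4∈S))
      where
      shift : ∀ r q → r + 4 * suc q ≡ (r + 4 * q) + 4
      shift = ℕ-Ring.solve-∀

    in-class : ∀ r q → coord r ≤ q → inClass r q ≡ true
    in-class r q le = trans (inClass-threshold r q) (≤ᵇ-true le)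

    coord-least : ∀ r q → inClass r q ≡ true → coord r ≤ q
    coord-least r q rq∈S = ≤ᵇ-sound (trans (sym (inClass-threshold r q)) rq∈S)

    coord-positive : ∀ r → S r ≡ false → 1 ≤ coord r
    coord-positive r r∉S with coord r in eq
    ... | suc _ = s≤s z≤n
    ... | zero  = ⊥-elim (true≢false (trans (sym (in-class r 0 (≤-reflexive eq))) (trans (cong S (+-identityʳ r)) r∉S)))

    -- F = 3 + 4⌊F/4⌋ is a gap, so ⌊F/4⌋ < k₃; every class reaches level k₃ beyond F.
    F≡ : F ≡ 3 + 4 * (F / 4)
    F≡ = trans (residue-split F) (cong (_+ 4 * (F / 4)) F%4)

    F/4<k₃ : F / 4 < k₃
    F/4<k₃ = ≰⇒> (λ k₃≤ → true≢false (trans (sym (in-class 3 (F / 4) k₃≤)) (trans (cong S (sym F≡)) F∉S)))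

    coord≤k₃ : ∀ r → coord r ≤ k₃
    coord≤k₃ r = coord-least r k₃ (beyond-F (r + 4 * k₃) F<)
      where
      F< : F < r + 4 * k₃
      F< = subst (_< r + 4 * k₃) (sym F≡)
             (≤-trans (subst (_≤ 4 * k₃) (*-suc 4 (F / 4)) (*-monoʳ-≤ 4 F/4<k₃)) (m≤n+m (4 * k₃) r))

    -- The coordinates satisfy the Kunz conditions: k₁, k₂ > 0 as 1, 2 ∉ S; subadditivity
    -- because 2(1 + 4k₁) and (1 + 4k₁) + (2 + 4k₂) are in S; k₁, k₂ ≤ k₃ by coord≤k₃.
    kunzConditions : Kunz k₁ k₂ k₃
    kunzConditions = record
      { k₁≥1 = coord-positive 1 (small-gap 1 (s≤s z≤n) 1<4)
      ; k₂≥1 = coord-positive 2 (small-gap 2 (s≤s z≤n) 2<4)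
      ; k₁≤k₃ = coord≤k₃ 1
      ; k₂≤k₃ = coord≤k₃ 2
      ; k₂≤2k₁ = coord-least 2 (2 * k₁)
          (trans (cong S (sym (double k₁))) (+-closed _ _ (in-class 1 k₁ ≤-refl) (in-class 1 k₁ ≤-refl)))
      ; k₃≤k₁+k₂ = coord-least 3 (k₁ + k₂)
          (trans (cong S (sym (mixed k₁ k₂))) (+-closed _ _ (in-class 1 k₁ ≤-refl) (in-class 2 k₂ ≤-refl)))
      }
      where
      double : ∀ a → (1 + 4 * a) + (1 + 4 * a) ≡ 2 + 4 * (2 * a)
      double = ℕ-Ring.solve-∀
      mixed : ∀ a b → (1 + 4 * a) + (2 + 4 * b) ≡ 3 + 4 * (a + b)
      mixed = ℕ-Ring.solve-∀

    S≐semigroupOf : S ≐ semigroupOf k₁ k₂ k₃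
    S≐semigroupOf n =
      trans (cong S (residue-split n))
            (trans (by-class (n % 4) (m%n<n n 4))
                   (sym (trans (cong (semigroupOf k₁ k₂ k₃) (residue-split n))
                               (semigroupOf-member k₁ k₂ k₃ (n % 4) (n / 4) (m%n<n n 4)))))
      where
      coord0 : coord 0 ≡ 0
      coord0 = n≤0⇒n≡0 (coord-least 0 0 zero∈)
      by-class : ∀ r → r < 4 → inClass r (n / 4) ≡ (kunz k₁ k₂ k₃ r ≤ᵇ n / 4)
      by-class 0 _ = trans (inClass-threshold 0 (n / 4)) (cong (_≤ᵇ n / 4) coord0)
      by-class 1 _ = inClass-threshold 1 (n / 4)
      by-class 2 _ = inClass-threshold 2 (n / 4)
      by-class 3 _ = inClass-threshold 3 (n / 4)
      by-class (suc (suc (suc (suc _)))) (s≤s (s≤s (s≤s (s≤s ()))))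

    -- Both S and the semigroup of its coordinates have g gaps.
    coordinates-sum : k₁ + k₂ + k₃ ≡ g
    coordinates-sum =
      trans (sym (FromCoordinates.genus kunzConditions))
            (trans (gapsBelow-≐ (sym ∘ S≐semigroupOf) (FromCoordinates.beyond-conductor kunzConditions)
                                (proj₁ (proj₂ genus)))
                   (proj₂ (proj₂ genus)))

-- Put a = k₁ and d = k₃ − k₁, so that k₃ = a + d and, for genus
-- g, k₂ = g − (2a + d).  The Kunz conditions then become the five inequalities of
-- Admissible g a d, and the counted semigroups correspond to its lattice points.
module Parametrization where

  open import Defs using (Subsetℕ; _≐_; N3Prop)
  open import Data.Nat
  open import Data.Nat.Properties
  open import Data.Product using (∃₂; _×_; _,_)
  open import Relation.Nullary using (Dec)
  open import Relation.Nullary.Decidable using (_×-dec_)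
  open import Relation.Binary.PropositionalEquality
  import Data.Nat.Tactic.RingSolver as ℕ-Ring
  open FiniteSums
  open KunzCoordinates

  -- In order: k₂ ≤ k₃, k₃ ≤ k₁ + k₂, k₂ ≤ 2k₁, k₂ ≥ 1 and k₁ ≥ 1 for (k₁, k₂, k₃) = (a, g − 2a − d, a + d).
  Admissible : ℕ → ℕ → ℕ → Set
  Admissible g a d =
    (g ≤ 3 * a + 2 * d) × (2 * a + 2 * d ≤ g) × (g ≤ 4 * a + d) × (2 * a + d + 1 ≤ g) × (1 ≤ a)

  admissible? : ∀ g a d → Dec (Admissible g a d)
  admissible? g a d =
    (g ≤? 3 * a + 2 * d) ×-dec (2 * a + 2 * d ≤? g) ×-dec (g ≤? 4 * a + d) ×-dec (2 * a + d + 1 ≤? g) ×-dec (1 ≤? a)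

  -- N g counts the admissible points in [0, g]², which contains all of them (admissible-bounded).
  -- It is opaque, so that
  -- comparing N at arithmetically equal arguments never unfolds the double sum.
  opaque
    N : ℕ → ℕ
    N g = sumSquare (suc g) (λ a d → 𝟙 (admissible? g a d))

    N-def : ∀ g → N g ≡ sumSquare (suc g) (λ a d → 𝟙 (admissible? g a d))
    N-def g = refl

  -- 2a + 2d ≤ g bounds both coordinates by g.
  admissible-bounded : ∀ {g a d} → Admissible g a d → a ≤ g × d ≤ g
  admissible-bounded {g} {a} {d} (_ , 2a+2d≤g , _) =
    ≤-trans (≤-trans (m≤m+n a (a + 0)) (m≤m+n (2 * a) (2 * d))) 2a+2d≤g ,
    ≤-trans (≤-trans (m≤m+n d (d + 0)) (m≤n+m (2 * d) (2 * a))) 2a+2d≤g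

  semigroupAt : ℕ → ℕ → ℕ → Subsetℕ
  semigroupAt g a d = semigroupOf a (g ∸ (2 * a + d)) (a + d)

  -- Each inequality of Admissible is one Kunz condition, after cancelling 2a + d.
  admissible⇒kunz : ∀ {g a d} → Admissible g a d →
    Kunz a (g ∸ (2 * a + d)) (a + d) × a + (g ∸ (2 * a + d)) + (a + d) ≡ g
  admissible⇒kunz {g} {a} {d} (g≤3a+2d , 2a+2d≤g , g≤4a+d , 2a+d+1≤g , 1≤a) =
    record
      { k₁≥1 = 1≤a
      ; k₂≥1 = +-cancelˡ-≤ X _ _ (subst (X + 1 ≤_) g≡ 2a+d+1≤g)
      ; k₁≤k₃ = m≤m+n a d
      ; k₂≤k₃ = +-cancelˡ-≤ X _ _ (subst₂ _≤_ g≡ (3a+2d≡ a d) g≤3a+2d)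
      ; k₂≤2k₁ = +-cancelˡ-≤ X _ _ (subst₂ _≤_ g≡ (4a+d≡ a d) g≤4a+d)
      ; k₃≤k₁+k₂ = +-monoʳ-≤ a (+-cancelˡ-≤ X _ _ (subst₂ _≤_ (2a+2d≡ a d) g≡ 2a+2d≤g))
      } ,
    trans (sum≡ a d k₂) (sym g≡)
    where
    X : ℕ
    X = 2 * a + d
    k₂ : ℕ
    k₂ = g ∸ X
    g≡ : g ≡ X + k₂
    g≡ = sym (m+[n∸m]≡n (≤-trans (m≤m+n X 1) 2a+d+1≤g))
    3a+2d≡ : ∀ a d → 3 * a + 2 * d ≡ (2 * a + d) + (a + d)
    3a+2d≡ = ℕ-Ring.solve-∀
    4a+d≡ : ∀ a d → 4 * a + d ≡ (2 * a + d) + 2 * a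
    4a+d≡ = ℕ-Ring.solve-∀
    2a+2d≡ : ∀ a d → 2 * a + 2 * d ≡ (2 * a + d) + d
    2a+2d≡ = ℕ-Ring.solve-∀
    sum≡ : ∀ a d k → a + k + (a + d) ≡ (2 * a + d) + k
    sum≡ = ℕ-Ring.solve-∀

  admissible⇒N3 : ∀ {g a d} → Admissible g a d → N3Prop g (semigroupAt g a d)
  admissible⇒N3 {g} adm with admissible⇒kunz adm
  ... | K , sum≡g = subst (λ h → N3Prop h (semigroupAt g _ _)) sum≡g (FromCoordinates.isN3 K)

  N3⇒admissible : ∀ {g S} → N3Prop g S → ∃₂ λ a d → Admissible g a d × S ≐ semigroupAt g a d
  N3⇒admissible {g} {S} isN3 = a , d , admissible , S≐
    where
    open ToCoordinates isN3
    open Kunz kunzConditions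
    a : ℕ
    a = k₁
    d : ℕ
    d = k₃ ∸ k₁
    a+d≡k₃ : a + d ≡ k₃
    a+d≡k₃ = m+[n∸m]≡n k₁≤k₃
    Y : ℕ
    Y = 2 * a + d
    g≡ : g ≡ Y + k₂
    g≡ = trans (sym coordinates-sum) (trans (cong (λ t → a + k₂ + t) (sym a+d≡k₃)) (regroup a k₂ d))
      where
      regroup : ∀ a k d → a + k + (a + d) ≡ (2 * a + d) + k
      regroup = ℕ-Ring.solve-∀
    d≤k₂ : d ≤ k₂
    d≤k₂ = +-cancelˡ-≤ a _ _ (subst (_≤ a + k₂) (sym a+d≡k₃) k₃≤k₁+k₂)
    -- Each admissibility inequality is Y + (something) compared with Y + k₂ = g.
    via : ∀ {u v} → u ≡ Y + v → ∀ {x} → g ≡ Y + x → v ≤ x → u ≤ g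
    via {u} {v} u≡ {x} g≡′ v≤x = subst₂ _≤_ (sym u≡) (sym g≡′) (+-monoʳ-≤ Y v≤x)
    via′ : ∀ {u v} → u ≡ Y + v → v ≥ k₂ → g ≤ u
    via′ {u} {v} u≡ k₂≤v = subst₂ _≤_ (sym g≡) (sym u≡) (+-monoʳ-≤ Y k₂≤v)
    admissible : Admissible g a d
    admissible =
      via′ (e₁ a d) (subst (k₂ ≤_) (sym a+d≡k₃) k₂≤k₃) ,
      via (e₂ a d) g≡ d≤k₂ ,
      via′ (e₃ a d) k₂≤2k₁ ,
      via (e₄ a d) g≡ k₂≥1 ,
      k₁≥1
      where
      e₁ : ∀ a d → 3 * a + 2 * d ≡ (2 * a + d) + (a + d)
      e₁ = ℕ-Ring.solve-∀
      e₂ : ∀ a d → 2 * a + 2 * d ≡ (2 * a + d) + d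
      e₂ = ℕ-Ring.solve-∀
      e₃ : ∀ a d → 4 * a + d ≡ (2 * a + d) + 2 * a
      e₃ = ℕ-Ring.solve-∀
      e₄ : ∀ a d → 2 * a + d + 1 ≡ (2 * a + d) + 1
      e₄ = ℕ-Ring.solve-∀
    k₂≡ : g ∸ Y ≡ k₂
    k₂≡ = trans (cong (_∸ Y) g≡) (m+n∸m≡n Y k₂)
    S≐ : S ≐ semigroupAt g a d
    S≐ n = trans (S≐semigroupOf n) (cong₂ (λ u v → semigroupOf k₁ u v n) (sym k₂≡) (sym a+d≡k₃))

  threshold-injective : ∀ {k k′} → (∀ q → (k ≤ᵇ q) ≡ (k′ ≤ᵇ q)) → k ≡ k′
  threshold-injective {k} {k′} same =
    ≤-antisym (≤ᵇ-sound (trans (same k′) (≤ᵇ-true (≤-refl {k′}))))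
              (≤ᵇ-sound (trans (sym (same k)) (≤ᵇ-true (≤-refl {k}))))

  -- Distinct admissible points give distinct semigroups: a = k₁ and a + d = k₃ are
  -- recovered from the classes of 1 and 3.
  semigroupAt-injective : ∀ g {a d a′ d′} → semigroupAt g a d ≐ semigroupAt g a′ d′ → a ≡ a′ × d ≡ d′
  semigroupAt-injective g {a} {d} {a′} {d′} same = a≡a′ , +-cancelˡ-≡ a d d′ (trans k₃≡ (cong (_+ d′) (sym a≡a′)))
    where
    a≡a′ : a ≡ a′
    a≡a′ = threshold-injective λ q →
      trans (sym (semigroupOf-member a _ _ 1 q 1<4)) (trans (same (1 + 4 * q)) (semigroupOf-member a′ _ _ 1 q 1<4))
    k₃≡ : a + d ≡ a′ + d′
    k₃≡ = threshold-injective λ q →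
      trans (sym (semigroupOf-member a (g ∸ (2 * a + d)) (a + d) 3 q 3<4))
            (trans (same (3 + 4 * q)) (semigroupOf-member a′ (g ∸ (2 * a′ + d′)) (a′ + d′) 3 q 3<4))

module Enumeration where

  open import Defs using (Subsetℕ; _≐_; N3Prop; HasCount)
  open import Data.Nat
  open import Data.Nat.Properties
  open import Data.Nat.ListAction using (sum)
  open import Data.List using (List; []; _∷_; _++_; map; filter; length; upTo; cartesianProduct)
  open import Data.List.Properties using (length-++; length-map; filter-++; map-∘; map-cong)
  open import Data.List.Membership.Propositional using (_∈_)
  open import Data.List.Membership.Propositional.Properties using (∈-filter⁺; ∈-cartesianProduct⁺; ∈-upTo⁺)
  open import Data.List.Relation.Unary.All.Properties using (all-filter) renaming (map⁺ to All-map⁺)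
  open import Data.List.Relation.Unary.Any using (Any)
  import Data.List.Relation.Unary.Any as Any
  open import Data.List.Relation.Unary.Any.Properties using () renaming (map⁺ to Any-map⁺)
  import Data.List.Relation.Unary.All as All
  import Data.List.Relation.Unary.AllPairs as AllPairs
  open import Data.List.Relation.Unary.AllPairs.Properties using () renaming (map⁺ to AllPairs-map⁺)
  open import Data.List.Relation.Unary.Unique.Propositional.Properties using (filter⁺; cartesianProduct⁺; upTo⁺)
  open import Data.Product using (_×_; _,_; proj₁; proj₂; uncurry)
  open import Data.Bool using (true; false)
  open import Function using (_∘_)
  open import Relation.Nullary using (Dec; does; ¬_)
  open import Relation.Binary.PropositionalEquality
  open FiniteSums
  open Parametrization

  length-filter≡count : ∀ {A : Set} {P : A → Set} (P? : ∀ x → Dec (P x)) (xs : List A) →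
                        length (filter P? xs) ≡ sum (map (𝟙 ∘ P?) xs)
  length-filter≡count P? []       = refl
  length-filter≡count P? (x ∷ xs) with does (P? x)
  ... | true  = cong suc (length-filter≡count P? xs)
  ... | false = length-filter≡count P? xs

  count-product : ∀ {A B : Set} {P : A × B → Set} (P? : ∀ p → Dec (P p)) (xs : List A) (ys : List B) →
    length (filter P? (cartesianProduct xs ys)) ≡ sum (map (λ x → sum (map (λ y → 𝟙 (P? (x , y))) ys)) xs)
  count-product P? []       ys = refl
  count-product P? (x ∷ xs) ys =
    begin
      length (filter P? (map (x ,_) ys ++ cartesianProduct xs ys))
        ≡⟨ cong length (filter-++ P? (map (x ,_) ys) (cartesianProduct xs ys)) ⟩
      length (filter P? (map (x ,_) ys) ++ filter P? (cartesianProduct xs ys))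
        ≡⟨ length-++ (filter P? (map (x ,_) ys)) ⟩
      length (filter P? (map (x ,_) ys)) + length (filter P? (cartesianProduct xs ys))
        ≡⟨ cong₂ _+_ (trans (length-filter≡count P? (map (x ,_) ys)) (cong sum (sym (map-∘ ys))))
                     (count-product P? xs ys) ⟩
      sum (map (λ y → 𝟙 (P? (x , y))) ys) + sum (map (λ x → sum (map (λ y → 𝟙 (P? (x , y))) ys)) xs) ∎
    where open ≡-Reasoning

  admissiblePoint? : ∀ g (p : ℕ × ℕ) → Dec (Admissible g (proj₁ p) (proj₂ p))
  admissiblePoint? g (a , d) = admissible? g a d

  points : ℕ → List (ℕ × ℕ)
  points g = filter (admissiblePoint? g) (cartesianProduct (upTo (suc g)) (upTo (suc g)))

  length-points : ∀ g → length (points g) ≡ N g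
  length-points g =
    begin
      length (points g)
        ≡⟨ count-product (admissiblePoint? g) (upTo (suc g)) (upTo (suc g)) ⟩
      sum (map (λ a → sum (map (λ d → 𝟙 (admissible? g a d)) (upTo (suc g)))) (upTo (suc g)))
        ≡⟨ cong sum (map-cong (λ a → sum-upTo (suc g) (λ d → 𝟙 (admissible? g a d))) (upTo (suc g))) ⟩
      sum (map (λ a → sumBelow (suc g) (λ d → 𝟙 (admissible? g a d))) (upTo (suc g)))
        ≡⟨ sum-upTo (suc g) (λ a → sumBelow (suc g) (λ d → 𝟙 (admissible? g a d))) ⟩
      sumSquare (suc g) (λ a d → 𝟙 (admissible? g a d))
        ≡⟨ N-def g ⟨
      N g ∎
    where open ≡-Reasoning

  semigroups : ℕ → List Subsetℕ
  semigroups g = map (uncurry (semigroupAt g)) (points g)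

  all-N3 : ∀ g → All.All (N3Prop g) (semigroups g)
  all-N3 g = All-map⁺ (All.map admissible⇒N3 (all-filter (admissiblePoint? g) (cartesianProduct (upTo (suc g)) (upTo (suc g)))))

  -- Distinct points give distinct semigroups, since points is duplicate-free.
  all-distinct : ∀ g → AllPairs.AllPairs (λ S T → ¬ (S ≐ T)) (semigroups g)
  all-distinct g = AllPairs-map⁺ (AllPairs.map (λ p≢q same → p≢q (distinct same))
                     (filter⁺ (admissiblePoint? g) (cartesianProduct⁺ (upTo⁺ (suc g)) (upTo⁺ (suc g)))))
    where
    distinct : ∀ {p q} → uncurry (semigroupAt g) p ≐ uncurry (semigroupAt g) q → p ≡ q
    distinct same = uncurry (cong₂ _,_) (semigroupAt-injective g same)

  -- Every counted semigroup occurs, at the point given by its Kunz coordinates.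
  complete : ∀ g S → N3Prop g S → Any (S ≐_) (semigroups g)
  complete g S isN3 = Any-map⁺ {f = uncurry (semigroupAt g)} at-point
    where
    a : ℕ
    a = proj₁ (N3⇒admissible isN3)
    d : ℕ
    d = proj₁ (proj₂ (N3⇒admissible isN3))
    adm : Admissible g a d
    adm = proj₁ (proj₂ (proj₂ (N3⇒admissible isN3)))
    S≐ : S ≐ semigroupAt g a d
    S≐ = proj₂ (proj₂ (proj₂ (N3⇒admissible isN3)))
    in-points : (a , d) ∈ points g
    in-points = ∈-filter⁺ (admissiblePoint? g)
      (∈-cartesianProduct⁺ (∈-upTo⁺ (s≤s (proj₁ (admissible-bounded adm)))) (∈-upTo⁺ (s≤s (proj₂ (admissible-bounded adm)))))
      adm
    at-point : Any (λ p → S ≐ uncurry (semigroupAt g) p) (points g)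
    at-point = Any.map (λ { refl → S≐ }) in-points

  count : ∀ g → HasCount (N3Prop g) (N g)
  count g = semigroups g , all-N3 g , all-distinct g , complete g ,
            trans (length-map (uncurry (semigroupAt g)) (points g)) (length-points g)

-- Translation (a, d) ↦ (a + 1, d + 1) maps the polygon for g into the polygon for h = g + 5:
-- the inequalities h ≤ 3a + 2d and h ≤ 4a + d are shifted exactly, the others are relaxed.
-- The points not obtained this way lie on
--   Edge₁: d = 0 (k₁ = k₃),   Edge₂: 2(a + d) = h (k₂ = k₃),   Corner: d = 1, h = 2a + 3.
module Recurrence where

  open import Data.Nat
  open import Data.Nat.Properties
  open import Data.Product using (_×_; _,_; proj₁; proj₂)
  open import Data.Sum using (_⊎_; inj₁; inj₂)
  open import Data.Empty using (⊥; ⊥-elim)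
  open import Function using (_∘_)
  open import Relation.Nullary using (Dec; yes; no; ¬_)
  open import Relation.Nullary.Decidable using (_×-dec_)
  open import Relation.Binary.PropositionalEquality
  import Data.Nat.Tactic.RingSolver as ℕ-Ring
  open FiniteSums
  open Parametrization

  Translated : ℕ → ℕ → ℕ → Set
  Translated g zero    d       = ⊥
  Translated g (suc a) zero    = ⊥
  Translated g (suc a) (suc d) = Admissible g a d

  translated? : ∀ g a d → Dec (Translated g a d)
  translated? g zero    d       = no λ ()
  translated? g (suc a) zero    = no λ ()
  translated? g (suc a) (suc d) = admissible? g a d

  Edge₁ Edge₂ Corner : ℕ → ℕ → ℕ → Set
  Edge₁  h a d = (d ≡ 0) × (h ≤ 3 * a) × (2 * a + 1 ≤ h)
  Edge₂  h a d = (2 * (a + d) ≡ h) × (h ≤ 4 * a + d) × (1 ≤ d)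
  Corner h a d = (d ≡ 1) × (h ≡ 2 * a + 3) × (1 ≤ a)

  edge₁? : ∀ h a d → Dec (Edge₁ h a d)
  edge₁? h a d = (d ≟ 0) ×-dec (h ≤? 3 * a) ×-dec (2 * a + 1 ≤? h)

  edge₂? : ∀ h a d → Dec (Edge₂ h a d)
  edge₂? h a d = (2 * (a + d) ≟ h) ×-dec (h ≤? 4 * a + d) ×-dec (1 ≤? d)

  corner? : ∀ h a d → Dec (Corner h a d)
  corner? h a d = (d ≟ 1) ×-dec (h ≟ 2 * a + 3) ×-dec (1 ≤? a)

  2d≤d⇒d≡0 : ∀ {d} → 2 * d ≤ d → d ≡ 0
  2d≤d⇒d≡0 {zero}  _          = refl
  2d≤d⇒d≡0 {suc d} (s≤s 2d≤d) = ⊥-elim (<⇒≱ (m<m+n d (s≤s z≤n)) 2d≤d)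

  shift-3a+2d : ∀ a d → 3 * suc a + 2 * suc d ≡ 5 + (3 * a + 2 * d)
  shift-3a+2d = ℕ-Ring.solve-∀
  shift-2a+2d : ∀ a d → 2 * suc a + 2 * suc d ≡ 4 + (2 * a + 2 * d)
  shift-2a+2d = ℕ-Ring.solve-∀
  shift-4a+d : ∀ a d → 4 * suc a + suc d ≡ 5 + (4 * a + d)
  shift-4a+d = ℕ-Ring.solve-∀
  shift-2a+d+1 : ∀ a d → 2 * suc a + suc d + 1 ≡ 3 + (2 * a + d + 1)
  shift-2a+d+1 = ℕ-Ring.solve-∀

  module _ (g : ℕ) where
    private
      h : ℕ
      h = 5 + g

    translated⇒admissible : ∀ a d → Translated g a d → Admissible h a d
    translated⇒admissible (suc a) (suc d) (g≤3a+2d , 2a+2d≤g , g≤4a+d , 2a+d+1≤g , _) =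
      subst (h ≤_) (sym (shift-3a+2d a d)) (+-monoʳ-≤ 5 g≤3a+2d) ,
      subst (_≤ h) (sym (shift-2a+2d a d)) (≤-trans (+-monoʳ-≤ 4 2a+2d≤g) (n≤1+n (4 + g))) ,
      subst (h ≤_) (sym (shift-4a+d a d)) (+-monoʳ-≤ 5 g≤4a+d) ,
      subst (_≤ h) (sym (shift-2a+d+1 a d)) (≤-trans (+-monoʳ-≤ 3 2a+d+1≤g) (+-monoˡ-≤ g (s≤s (s≤s (s≤s z≤n))))) ,
      s≤s z≤n

    descend : ∀ a d → Admissible h (suc a) (suc d) → (g ≤ 3 * a + 2 * d) × (g ≤ 4 * a + d)
    descend a d (h≤ , _ , h≤′ , _ , _) =
      +-cancelˡ-≤ 5 _ _ (subst (h ≤_) (shift-3a+2d a d) h≤) , +-cancelˡ-≤ 5 _ _ (subst (h ≤_) (shift-4a+d a d) h≤′)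

    boundary : ∀ a d → Admissible h a d → ¬ Translated g a d → Edge₁ h a d ⊎ Edge₂ h a d ⊎ Corner h a d
    boundary zero    d       (_ , _ , _ , _ , ()) _
    boundary (suc a) zero    (h≤ , _ , _ , 2a+1≤h , _) _ =
      inj₁ (refl , subst (h ≤_) (+-identityʳ _) h≤ , subst (λ x → x + 1 ≤ h) (+-identityʳ (2 * suc a)) 2a+1≤h)
    boundary (suc a) (suc d) adm@(_ , 2a+2d≤h , h≤4a+d , _ , _) ¬tr
      with 2 * a + 2 * d ≤? g | 2 * a + d + 1 ≤? g
    ... | no g<2a+2d | _ = inj₂ (inj₁ (trans (*-distribˡ-+ 2 (suc a) (suc d)) (≤-antisym 2a+2d≤h h≤) , h≤4a+d , s≤s z≤n))
      where
      h≤ : h ≤ 2 * suc a + 2 * suc d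
      h≤ = subst (h ≤_) (sym (shift-2a+2d a d)) (+-monoʳ-≤ 4 (≰⇒> g<2a+2d))
    ... | yes 2a+2d≤g | no g≤2a+d = inj₂ (inj₂ (cong suc d≡0 , h≡ , s≤s z≤n))
      where
      g≤ : g ≤ 2 * a + d
      g≤ = ≤-pred (subst (g <_) (+-comm (2 * a + d) 1) (≰⇒> g≤2a+d))
      d≡0 : d ≡ 0
      d≡0 = 2d≤d⇒d≡0 (+-cancelˡ-≤ (2 * a) _ _ (≤-trans 2a+2d≤g g≤))
      g≡2a : g ≡ 2 * a
      g≡2a = ≤-antisym (subst (g ≤_) (+-identityʳ (2 * a)) (subst (λ x → g ≤ 2 * a + x) d≡0 g≤))
                       (≤-trans (m≤m+n (2 * a) (2 * d)) 2a+2d≤g)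
      h≡ : h ≡ 2 * suc a + 3
      h≡ = trans (cong (5 +_) g≡2a) (5+2a≡ a)
        where
        5+2a≡ : ∀ a → 5 + 2 * a ≡ 2 * suc a + 3
        5+2a≡ = ℕ-Ring.solve-∀
    ... | yes 2a+2d≤g | yes 2a+d+1≤g =
      ⊥-elim (¬tr (g≤3a+2d , 2a+2d≤g , g≤4a+d , 2a+d+1≤g , positive a 2a+d+1≤g g≤4a+d))
      where
      g≤3a+2d : g ≤ 3 * a + 2 * d
      g≤3a+2d = proj₁ (descend a d adm)
      g≤4a+d : g ≤ 4 * a + d
      g≤4a+d = proj₂ (descend a d adm)
      positive : ∀ a → 2 * a + d + 1 ≤ g → g ≤ 4 * a + d → 1 ≤ a
      positive (suc _) _        _      = s≤s z≤n
      positive zero    d+1≤g g≤d = ⊥-elim (<⇒≱ (subst (_≤ g) (+-comm d 1) d+1≤g) g≤d)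

    edge₁⇒admissible : ∀ a d → Edge₁ h a d → Admissible h a d
    edge₁⇒admissible a .0 (refl , h≤3a , 2a+1≤h) =
      subst (h ≤_) (sym (+-identityʳ (3 * a))) h≤3a ,
      subst (_≤ h) (sym (+-identityʳ (2 * a))) (≤-trans (m≤m+n (2 * a) 1) 2a+1≤h) ,
      subst (h ≤_) (sym (4a+0≡ a)) (≤-trans h≤3a (m≤m+n (3 * a) a)) ,
      subst (λ x → x + 1 ≤ h) (sym (+-identityʳ (2 * a))) 2a+1≤h ,
      positive a h≤3a
      where
      4a+0≡ : ∀ a → 4 * a + 0 ≡ 3 * a + a
      4a+0≡ = ℕ-Ring.solve-∀
      positive : ∀ a → h ≤ 3 * a → 1 ≤ a
      positive (suc _) _  = s≤s z≤n
      positive zero    ()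

    edge₂⇒admissible : ∀ a d → Edge₂ h a d → Admissible h a d
    edge₂⇒admissible a d (2[a+d]≡h , h≤4a+d , 1≤d) =
      subst (_≤ 3 * a + 2 * d) 2a+2d≡h (+-monoˡ-≤ (2 * d) (*-monoˡ-≤ a (n≤1+n 2))) ,
      ≤-reflexive 2a+2d≡h ,
      h≤4a+d ,
      subst (2 * a + d + 1 ≤_) (trans (2a+d+d≡ a d) 2a+2d≡h) (+-monoʳ-≤ (2 * a + d) 1≤d) ,
      positive a 2[a+d]≡h h≤4a+d
      where
      2a+2d≡h : 2 * a + 2 * d ≡ h
      2a+2d≡h = trans (sym (*-distribˡ-+ 2 a d)) 2[a+d]≡h
      2a+d+d≡ : ∀ a d → 2 * a + d + d ≡ 2 * a + 2 * d
      2a+d+d≡ = ℕ-Ring.solve-∀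
      positive : ∀ a → 2 * (a + d) ≡ h → h ≤ 4 * a + d → 1 ≤ a
      positive (suc _) _  _   = s≤s z≤n
      positive zero    2d≡h h≤d = ⊥-elim (<⇒≱ 1≤d (≤-reflexive (2d≤d⇒d≡0 (subst (_≤ d) (sym 2d≡h) h≤d))))

    corner⇒admissible : ∀ a d → Corner h a d → Admissible h a d
    corner⇒admissible (suc a) .1 (refl , h≡ , _) rewrite h≡ =
      by a (e₁ a) , by 1 (e₂ a) , by (2 * a) (e₃ a) , by 1 (e₄ a) , s≤s z≤n
      where
      by : ∀ {x y} k → y ≡ x + k → x ≤ y
      by {x} k refl = m≤m+n x k
      e₁ : ∀ a → 3 * suc a + 2 * 1 ≡ (2 * suc a + 3) + a
      e₁ = ℕ-Ring.solve-∀
      e₂ : ∀ a → 2 * suc a + 3 ≡ (2 * suc a + 2 * 1) + 1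
      e₂ = ℕ-Ring.solve-∀
      e₃ : ∀ a → 4 * suc a + 1 ≡ (2 * suc a + 3) + 2 * a
      e₃ = ℕ-Ring.solve-∀
      e₄ : ∀ a → 2 * suc a + 3 ≡ (2 * suc a + 1 + 1) + 1
      e₄ = ℕ-Ring.solve-∀

    edge₁⇒¬translated : ∀ a d → Edge₁ h a d → ¬ Translated g a d
    edge₁⇒¬translated zero    .0 (refl , _) ()
    edge₁⇒¬translated (suc a) .0 (refl , _) ()

    -- On Edge₂, 2(a + d) = g + 1 > g at the untranslated point.
    edge₂⇒¬translated : ∀ a d → Edge₂ h a d → ¬ Translated g a d
    edge₂⇒¬translated (suc a) (suc d) (2[a+d]≡h , _) (_ , 2a+2d≤g , _) =
      <⇒≱ (≤-reflexive (sym (+-cancelˡ-≡ 4 _ _ (trans (sym (e a d)) 2[a+d]≡h)))) 2a+2d≤g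
      where
      e : ∀ a d → 2 * (suc a + suc d) ≡ 4 + (2 * a + 2 * d)
      e = ℕ-Ring.solve-∀

    -- At the corner, g = 2a < 2a + 1 at the untranslated point.
    corner⇒¬translated : ∀ a d → Corner h a d → ¬ Translated g a d
    corner⇒¬translated (suc a) .1 (refl , h≡ , _) (_ , _ , _ , 2a+1≤g , _) =
      <-irrefl refl (subst (_≤ 2 * a) (e₂ a) (subst (2 * a + 0 + 1 ≤_) (+-cancelˡ-≡ 5 _ _ (trans h≡ (e₁ a))) 2a+1≤g))
      where
      e₁ : ∀ a → 2 * suc a + 3 ≡ 5 + 2 * a
      e₁ = ℕ-Ring.solve-∀
      e₂ : ∀ a → 2 * a + 0 + 1 ≡ suc (2 * a)
      e₂ = ℕ-Ring.solve-∀

    -- Edge₂ and Corner are disjoint by parity of h.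
    edge₂⇒¬corner : ∀ a d → Edge₂ h a d → ¬ Corner h a d
    edge₂⇒¬corner a .1 (2[a+1]≡h , _) (refl , h≡ , _) =
      <-irrefl (+-cancelˡ-≡ (2 * a) _ _ (trans (sym (e a)) (trans 2[a+1]≡h h≡))) ≤-refl
      where
      e : ∀ a → 2 * (a + 1) ≡ 2 * a + 2
      e = ℕ-Ring.solve-∀

    admissible-split : ∀ a d →
      𝟙 (admissible? h a d) ≡ 𝟙 (translated? g a d) + 𝟙 (edge₁? h a d) + 𝟙 (edge₂? h a d) + 𝟙 (corner? h a d)
    admissible-split a d =
      𝟙-partition (admissible? h a d) (translated? g a d) (edge₁? h a d) (edge₂? h a d) (corner? h a d)
        (translated⇒admissible a d) (edge₁⇒admissible a d) (edge₂⇒admissible a d) (corner⇒admissible a d)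
        (boundary a d)
        (edge₁⇒¬translated a d) (edge₂⇒¬translated a d) (corner⇒¬translated a d)
        (λ { (refl , _) (_ , _ , ()) }) (λ { (refl , _) (() , _) }) (edge₂⇒¬corner a d)

  edge₁Count edge₂Count cornerCount : ℕ → ℕ
  edge₁Count  h = sumSquare (suc h) (λ a d → 𝟙 (edge₁? h a d))
  edge₂Count  h = sumSquare (suc h) (λ a d → 𝟙 (edge₂? h a d))
  cornerCount h = sumSquare (suc h) (λ a d → 𝟙 (corner? h a d))

  -- Opaque, so that comparing boundary counts at different arguments never unfolds the sums.
  opaque
    boundaryCount : ℕ → ℕ
    boundaryCount h = edge₁Count h + edge₂Count h + cornerCount h

    boundaryCount-def : ∀ h → boundaryCount h ≡ edge₁Count h + edge₂Count h + cornerCount h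
    boundaryCount-def h = refl

  N-over : ∀ g M → suc g ≤ M → sumSquare M (λ a d → 𝟙 (admissible? g a d)) ≡ N g
  N-over g M g<M =
    begin
      sumSquare M (λ a d → 𝟙 (admissible? g a d))
        ≡⟨ sumBelow-cong M (λ a _ → sumBelow-extend M _ g<M (λ d g<d →
             𝟙-no (admissible? g a d) (<⇒≱ g<d ∘ proj₂ ∘ admissible-bounded))) ⟩
      sumBelow M (λ a → sumBelow (suc g) (λ d → 𝟙 (admissible? g a d)))
        ≡⟨ sumBelow-extend M _ g<M (λ a g<a → sumBelow-zero (suc g) _ (λ d _ →
             𝟙-no (admissible? g a d) (<⇒≱ g<a ∘ proj₁ ∘ admissible-bounded))) ⟩
      sumSquare (suc g) (λ a d → 𝟙 (admissible? g a d))
        ≡⟨ N-def g ⟨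
      N g ∎
    where open ≡-Reasoning

  -- The translated points are counted by N g: drop the empty row a = 0 and column d = 0.
  translated-count : ∀ g → sumSquare (6 + g) (λ a d → 𝟙 (translated? g a d)) ≡ N g
  translated-count g =
    begin
      sumSquare (6 + g) (λ a d → 𝟙 (translated? g a d))
        ≡⟨ sumBelow-first (5 + g) _ ⟩
      sumBelow (6 + g) (λ d → 𝟙 (translated? g 0 d))
        + sumBelow (5 + g) (λ a → sumBelow (6 + g) (λ d → 𝟙 (translated? g (suc a) d)))
        ≡⟨ cong₂ _+_ (sumBelow-zero (6 + g) _ (λ _ _ → refl))
                     (sumBelow-cong (5 + g) (λ a _ → sumBelow-first (5 + g) _)) ⟩
      sumSquare (5 + g) (λ a d → 𝟙 (admissible? g a d))
        ≡⟨ N-over g (5 + g) (s≤s (m≤n+m g 4)) ⟩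
      N g ∎
    where open ≡-Reasoning

  N-step : ∀ g → N (5 + g) ≡ N g + boundaryCount (5 + g)
  N-step g =
    begin
      N (5 + g)
        ≡⟨ N-def (5 + g) ⟩
      sumSquare (6 + g) (λ a d → 𝟙 (admissible? h a d))
        ≡⟨ sumSquare-cong (6 + g) (admissible-split g) ⟩
      sumSquare (6 + g) (λ a d → 𝟙 (translated? g a d) + 𝟙 (edge₁? h a d) + 𝟙 (edge₂? h a d) + 𝟙 (corner? h a d))
        ≡⟨ sumSquare-+ (6 + g) _ _ ⟩
      sumSquare (6 + g) (λ a d → 𝟙 (translated? g a d) + 𝟙 (edge₁? h a d) + 𝟙 (edge₂? h a d)) + cornerCount h
        ≡⟨ cong (_+ cornerCount h) (sumSquare-+ (6 + g) _ _) ⟩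
      sumSquare (6 + g) (λ a d → 𝟙 (translated? g a d) + 𝟙 (edge₁? h a d)) + edge₂Count h + cornerCount h
        ≡⟨ cong (λ x → x + edge₂Count h + cornerCount h) (sumSquare-+ (6 + g) _ _) ⟩
      sumSquare (6 + g) (λ a d → 𝟙 (translated? g a d)) + edge₁Count h + edge₂Count h + cornerCount h
        ≡⟨ cong (λ x → x + edge₁Count h + edge₂Count h + cornerCount h) (translated-count g) ⟩
      N g + edge₁Count h + edge₂Count h + cornerCount h
        ≡⟨ regroup (N g) (edge₁Count h) (edge₂Count h) (cornerCount h) ⟩
      N g + (edge₁Count h + edge₂Count h + cornerCount h)
        ≡⟨ cong (N g +_) (boundaryCount-def h) ⟨
      N g + boundaryCount h ∎
    where
    open ≡-Reasoning
    h : ℕ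
    h = 5 + g
    regroup : ∀ n a b c → n + a + b + c ≡ n + (a + b + c)
    regroup = ℕ-Ring.solve-∀

module Periodicity where

  open import Data.Nat
  open import Data.Nat.Properties
  open import Data.Nat.DivMod
  open import Data.Product using (∃; _×_; _,_; proj₁; proj₂)
  open import Data.Sum using (_⊎_; inj₁; inj₂)
  open import Relation.Nullary.Decidable using (_×-dec_)
  open import Relation.Binary.PropositionalEquality
  import Data.Nat.Tactic.RingSolver as ℕ-Ring
  open FiniteSums
  open FloorDivision
  open Parametrization using (N)
  open Recurrence

  -- Edge₁ for h = x + 1 is {(a, 0) | ⌊x/3⌋ < a ≤ ⌊x/2⌋}.
  edge₁Count-closed : ∀ x → edge₁Count (suc x) ≡ x / 2 ∸ x / 3
  edge₁Count-closed x =
    trans (sumBelow-cong (suc h) (λ a _ →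
             trans (count-unique (edge₁? h a) 0 (suc h) (λ d → proj₁) (s≤s z≤n)) (in-range a)))
          (count-interval (suc (x / 3)) (x / 2) (suc h) (s≤s (≤-trans (m/n≤m x 2) (n≤1+n x))))
    where
    h : ℕ
    h = suc x
    2a+1≡ : ∀ a → 2 * a + 1 ≡ suc (2 * a)
    2a+1≡ a = +-comm (2 * a) 1
    in-range : ∀ a → 𝟙 (edge₁? h a 0) ≡ 𝟙 ((suc (x / 3) ≤? a) ×-dec (a ≤? x / 2))
    in-range a = 𝟙-⇔ (edge₁? h a 0) ((suc (x / 3) ≤? a) ×-dec (a ≤? x / 2))
      (λ { (_ , h≤3a , 2a+1≤h) → <*⇒/< 3 a x h≤3a , *≤⇒≤/ 2 a x (≤-pred (subst (_≤ h) (2a+1≡ a) 2a+1≤h)) })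
      (λ { (x/3<a , a≤x/2) → refl , /<⇒<* 3 a x x/3<a , subst (_≤ h) (sym (2a+1≡ a)) (s≤s (≤/⇒*≤ 2 a x a≤x/2)) })

  -- Edge₂ for h = 2s is {(a, s − a) | ⌊(s − 1)/3⌋ < a ≤ s − 1}, as 2s ≤ 4a + (s − a) ⇔ s ≤ 3a.
  edge₂Count-even : ∀ s′ → edge₂Count (2 * suc s′) ≡ s′ ∸ s′ / 3
  edge₂Count-even s′ =
    trans (sumBelow-cong (suc h) (λ a _ →
             trans (count-unique (edge₂? h a) (s ∸ a) (suc h) (only a) (s≤s (≤-trans (m∸n≤m s a) s≤h)))
                   (in-range a)))
          (count-interval (suc (s′ / 3)) s′ (suc h) (s≤s (≤-trans (n≤1+n s′) s≤h)))
    where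
    s : ℕ
    s = suc s′
    h : ℕ
    h = 2 * s
    s≤h : s ≤ h
    s≤h = m≤m+n s (s + 0)
    only : ∀ a d → Edge₂ h a d → d ≡ s ∸ a
    only a d (2[a+d]≡h , _) = sym (trans (cong (_∸ a) (sym (*-cancelˡ-≡ (a + d) s 2 2[a+d]≡h))) (m+n∸m≡n a d))
    2[a+e]≡ : ∀ a e → 2 * (a + e) ≡ (a + e) + (a + e)
    2[a+e]≡ = ℕ-Ring.solve-∀
    4a+e≡ : ∀ a e → 4 * a + e ≡ (a + e) + 3 * a
    4a+e≡ = ℕ-Ring.solve-∀
    key : ∀ a e → 2 * (a + e) ≤ 4 * a + e → a + e ≤ 3 * a
    key a e le = +-cancelˡ-≤ (a + e) _ _ (subst₂ _≤_ (2[a+e]≡ a e) (4a+e≡ a e) le)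
    key⁻¹ : ∀ a e → a + e ≤ 3 * a → 2 * (a + e) ≤ 4 * a + e
    key⁻¹ a e le = subst₂ _≤_ (sym (2[a+e]≡ a e)) (sym (4a+e≡ a e)) (+-monoʳ-≤ (a + e) le)
    in-range : ∀ a → 𝟙 (edge₂? h a (s ∸ a)) ≡ 𝟙 ((suc (s′ / 3) ≤? a) ×-dec (a ≤? s′))
    in-range a = 𝟙-⇔ (edge₂? h a (s ∸ a)) ((suc (s′ / 3) ≤? a) ×-dec (a ≤? s′))
      (λ { (_ , h≤ , 1≤s∸a) →
             let a<s = ≰⇒> (λ s≤a → <⇒≱ 1≤s∸a (≤-reflexive (m≤n⇒m∸n≡0 s≤a)))
                 a+[s∸a]≡s = m+[n∸m]≡n (<⇒≤ a<s)
             in <*⇒/< 3 a s′ (subst (_≤ 3 * a) a+[s∸a]≡s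
                  (key a (s ∸ a) (subst (_≤ 4 * a + (s ∸ a)) (cong (2 *_) (sym a+[s∸a]≡s)) h≤))) ,
                ≤-pred a<s })
      (λ { (s′/3<a , a≤s′) →
             let a+[s∸a]≡s = m+[n∸m]≡n (m≤n⇒m≤1+n a≤s′)
             in cong (2 *_) a+[s∸a]≡s ,
                subst (_≤ 4 * a + (s ∸ a)) (cong (2 *_) a+[s∸a]≡s)
                  (key⁻¹ a (s ∸ a) (subst (_≤ 3 * a) (sym a+[s∸a]≡s) (/<⇒<* 3 a s′ s′/3<a))) ,
                m<n⇒0<n∸m (s≤s a≤s′) })

  -- Edge₂ lies on the line 2(a + d) = h, so it is empty for odd h.
  edge₂Count-odd : ∀ s → edge₂Count (suc (2 * s)) ≡ 0
  edge₂Count-odd s = sumBelow-zero (2 + 2 * s) _ (λ a _ →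
    count-none (edge₂? (suc (2 * s)) a) (2 + 2 * s) (λ d on-edge → even≢odd (a + d) s (proj₁ on-edge)))

  -- The corner needs h = 2a + 3 odd, and then it is the single point (h − 3)/2 when that is ≥ 1.
  2a+3≡ : ∀ a → 2 * a + 3 ≡ suc (2 * suc a)
  2a+3≡ = ℕ-Ring.solve-∀

  cornerCount-even : ∀ s → cornerCount (2 * s) ≡ 0
  cornerCount-even s = sumBelow-zero (suc (2 * s)) _ (λ a _ →
    count-none (corner? (2 * s) a) (suc (2 * s)) (λ d at-corner → even≢odd s (suc a) (trans (proj₁ (proj₂ at-corner)) (2a+3≡ a))))

  cornerCount-odd : ∀ t → 1 ≤ t → cornerCount (2 * t + 3) ≡ 1
  cornerCount-odd t 1≤t =
    trans (sumBelow-cong (suc h) (λ a _ → count-unique (corner? h a) 1 (suc h) (λ d → proj₁) (s≤s (≤-trans (s≤s z≤n) (m≤n+m 3 (2 * t))))))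
          (trans (count-unique (λ a → corner? h a 1) t (suc h) only t<1+h) (𝟙-yes (corner? h t 1) (refl , refl , 1≤t)))
    where
    h : ℕ
    h = 2 * t + 3
    only : ∀ a → Corner h a 1 → a ≡ t
    only a (_ , h≡ , _) = sym (*-cancelˡ-≡ t a 2 (+-cancelʳ-≡ 3 _ _ h≡))
    t<1+h : t < suc h
    t<1+h = s≤s (≤-trans (m≤n*m t 2) (m≤m+n (2 * t) 3))

  ∸-shift : ∀ a b c k → b ≤ a → (a + (k + c)) ∸ (b + k) ≡ (a ∸ b) + c
  ∸-shift a b c k b≤a =
    trans (cong₂ _∸_ (regroup a k c) (+-comm b k)) (trans ([m+n]∸[m+o]≡n∸o k (a + c) b) (+-∸-comm c b≤a))
    where
    regroup : ∀ a k c → a + (k + c) ≡ k + (a + c)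
    regroup = ℕ-Ring.solve-∀

  edge₁Count-shift : ∀ h → 1 ≤ h → edge₁Count (30 + h) ≡ edge₁Count h + 5
  edge₁Count-shift (suc x) _ = begin
      edge₁Count (30 + suc x)                 ≡⟨ cong edge₁Count (e x) ⟩
      edge₁Count (suc (x + 30))               ≡⟨ edge₁Count-closed (x + 30) ⟩
      (x + 15 * 2) / 2 ∸ (x + 10 * 3) / 3     ≡⟨ cong₂ _∸_ (/-shift x 15 2) (/-shift x 10 3) ⟩
      (x / 2 + 15) ∸ (x / 3 + 10)             ≡⟨ ∸-shift (x / 2) (x / 3) 5 10 (/-monoʳ-≤ x (s≤s (s≤s z≤n))) ⟩
      (x / 2 ∸ x / 3) + 5                     ≡⟨ cong (_+ 5) (edge₁Count-closed x) ⟨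
      edge₁Count (suc x) + 5 ∎
    where
    open ≡-Reasoning
    e : ∀ x → 30 + suc x ≡ suc (x + 30)
    e = ℕ-Ring.solve-∀

  edge₂Count-shift : ∀ s → edge₂Count (30 + 2 * suc s) ≡ edge₂Count (2 * suc s) + 10
  edge₂Count-shift s = begin
      edge₂Count (30 + 2 * suc s)       ≡⟨ cong edge₂Count (e s) ⟩
      edge₂Count (2 * suc (s + 5 * 3))  ≡⟨ edge₂Count-even (s + 5 * 3) ⟩
      (s + 15) ∸ (s + 5 * 3) / 3        ≡⟨ cong ((s + 15) ∸_) (/-shift s 5 3) ⟩
      (s + 15) ∸ (s / 3 + 5)            ≡⟨ ∸-shift s (s / 3) 10 5 (m/n≤m s 3) ⟩
      (s ∸ s / 3) + 10                  ≡⟨ cong (_+ 10) (edge₂Count-even s) ⟨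
      edge₂Count (2 * suc s) + 10 ∎
    where
    open ≡-Reasoning
    e : ∀ s → 30 + 2 * suc s ≡ 2 * suc (s + 5 * 3)
    e = ℕ-Ring.solve-∀

  -- For h ≥ 2 even the boundary gains 5 + 10 + 0 points under h ↦ h + 30, for h ≥ 5 odd 5 + 0 + 0.
  boundaryCount-shift-even : ∀ s → boundaryCount (30 + 2 * suc s) ≡ boundaryCount (2 * suc s) + 15
  boundaryCount-shift-even s = begin
      boundaryCount (30 + h)
        ≡⟨ boundaryCount-def (30 + h) ⟩
      edge₁Count (30 + h) + edge₂Count (30 + h) + cornerCount (30 + h)
        ≡⟨ cong₂ _+_ (cong₂ _+_ (edge₁Count-shift h (s≤s z≤n)) (edge₂Count-shift s)) corner-shift ⟩
      (edge₁Count h + 5) + (edge₂Count h + 10) + cornerCount h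
        ≡⟨ regroup (edge₁Count h) (edge₂Count h) (cornerCount h) ⟩
      edge₁Count h + edge₂Count h + cornerCount h + 15
        ≡⟨ cong (_+ 15) (boundaryCount-def h) ⟨
      boundaryCount h + 15 ∎
    where
    open ≡-Reasoning
    h : ℕ
    h = 2 * suc s
    corner-shift : cornerCount (30 + h) ≡ cornerCount h
    corner-shift = trans (cong cornerCount (e s)) (trans (cornerCount-even (suc s + 15)) (sym (cornerCount-even (suc s))))
      where
      e : ∀ s → 30 + 2 * suc s ≡ 2 * (suc s + 15)
      e = ℕ-Ring.solve-∀
    regroup : ∀ a b c → (a + 5) + (b + 10) + c ≡ a + b + c + 15
    regroup = ℕ-Ring.solve-∀

  boundaryCount-shift-odd : ∀ t → 1 ≤ t → boundaryCount (30 + (2 * t + 3)) ≡ boundaryCount (2 * t + 3) + 5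
  boundaryCount-shift-odd t 1≤t = begin
      boundaryCount (30 + h)
        ≡⟨ boundaryCount-def (30 + h) ⟩
      edge₁Count (30 + h) + edge₂Count (30 + h) + cornerCount (30 + h)
        ≡⟨ cong₂ _+_ (cong₂ _+_ (edge₁Count-shift h 1≤h) (trans edge₂-odd (sym edge₂-odd′))) corner-shift ⟩
      (edge₁Count h + 5) + edge₂Count h + cornerCount h
        ≡⟨ regroup (edge₁Count h) (edge₂Count h) (cornerCount h) ⟩
      edge₁Count h + edge₂Count h + cornerCount h + 5
        ≡⟨ cong (_+ 5) (boundaryCount-def h) ⟨
      boundaryCount h + 5 ∎
    where
    open ≡-Reasoning
    h : ℕ
    h = 2 * t + 3
    1≤h : 1 ≤ h
    1≤h = ≤-trans (s≤s z≤n) (m≤n+m 3 (2 * t))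
    edge₂-odd : edge₂Count (30 + h) ≡ 0
    edge₂-odd = trans (cong edge₂Count (e t)) (edge₂Count-odd (suc (t + 15)))
      where
      e : ∀ t → 30 + (2 * t + 3) ≡ suc (2 * suc (t + 15))
      e = ℕ-Ring.solve-∀
    edge₂-odd′ : edge₂Count h ≡ 0
    edge₂-odd′ = trans (cong edge₂Count (2a+3≡ t)) (edge₂Count-odd (suc t))
    corner-shift : cornerCount (30 + h) ≡ cornerCount h
    corner-shift = trans (cong cornerCount (e t))
                         (trans (cornerCount-odd (t + 15) (≤-trans 1≤t (m≤m+n t 15))) (sym (cornerCount-odd t 1≤t)))
      where
      e : ∀ t → 30 + (2 * t + 3) ≡ 2 * (t + 15) + 3
      e = ℕ-Ring.solve-∀
    regroup : ∀ a b c → (a + 5) + b + c ≡ a + b + c + 5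
    regroup = ℕ-Ring.solve-∀

  even-or-odd : ∀ n → (∃ λ s → n ≡ 2 * s) ⊎ (∃ λ s → n ≡ suc (2 * s))
  even-or-odd zero    = inj₁ (0 , refl)
  even-or-odd (suc n) with even-or-odd n
  ... | inj₁ (s , refl) = inj₂ (s , refl)
  ... | inj₂ (s , refl) = inj₁ (suc s , cong suc (sym (+-suc s (s + 0))))

  shifted : ∀ {h h′ c} → h ≡ h′ → boundaryCount (30 + h′) ≡ boundaryCount h′ + c → boundaryCount (30 + h) ≡ boundaryCount h + c
  shifted {c = c} refl shift = shift

  -- h and h + 5 have opposite parity, so together they gain 15 + 5 = 20 points.
  boundaryCount-pair : ∀ h → 5 ≤ h → boundaryCount (30 + h) + boundaryCount (35 + h) ≡ boundaryCount h + boundaryCount (5 + h) + 20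
  boundaryCount-pair h 5≤h with even-or-odd h
  boundaryCount-pair .0 () | inj₁ (zero , refl)
  boundaryCount-pair .(2 * suc s) _ | inj₁ (suc s , refl) =
    trans (cong₂ _+_ (boundaryCount-shift-even s) (shifted (e s) (boundaryCount-shift-odd (suc (suc s)) (s≤s z≤n))))
          (regroup (boundaryCount (2 * suc s)) (boundaryCount (5 + 2 * suc s)))
    where
    e : ∀ s → 5 + 2 * suc s ≡ 2 * suc (suc s) + 3
    e = ℕ-Ring.solve-∀
    regroup : ∀ a b → (a + 15) + (b + 5) ≡ a + b + 20
    regroup = ℕ-Ring.solve-∀
  boundaryCount-pair .1 (s≤s ()) | inj₂ (zero , refl)
  boundaryCount-pair .3 (s≤s (s≤s (s≤s ()))) | inj₂ (suc zero , refl)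
  boundaryCount-pair .(suc (2 * suc (suc t))) _ | inj₂ (suc (suc t) , refl) =
    trans (cong₂ _+_ (shifted (e₁ t) (boundaryCount-shift-odd (suc t) (s≤s z≤n))) (shifted (e₂ t) (boundaryCount-shift-even (t + 4))))
          (regroup (boundaryCount (suc (2 * suc (suc t)))) (boundaryCount (5 + suc (2 * suc (suc t)))))
    where
    e₁ : ∀ t → suc (2 * suc (suc t)) ≡ 2 * suc t + 3
    e₁ = ℕ-Ring.solve-∀
    e₂ : ∀ t → 5 + suc (2 * suc (suc t)) ≡ 2 * suc (t + 4)
    e₂ = ℕ-Ring.solve-∀
    regroup : ∀ a b → (a + 5) + (b + 15) ≡ a + b + 20
    regroup = ℕ-Ring.solve-∀


  -- The boundary counts met while raising g by 30 in steps of 5.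
  window : ℕ → ℕ
  window g = boundaryCount (5 + g) + boundaryCount (10 + g) + boundaryCount (15 + g)
           + boundaryCount (20 + g) + boundaryCount (25 + g) + boundaryCount (30 + g)

  N-window : ∀ g → N (30 + g) ≡ N g + window g
  N-window g =
    begin
      N (30 + g)
        ≡⟨ N-step (25 + g) ⟩
      N (25 + g) + b 30
        ≡⟨ cong (_+ b 30) (N-step (20 + g)) ⟩
      N (20 + g) + b 25 + b 30
        ≡⟨ cong (λ x → x + b 25 + b 30) (N-step (15 + g)) ⟩
      N (15 + g) + b 20 + b 25 + b 30
        ≡⟨ cong (λ x → x + b 20 + b 25 + b 30) (N-step (10 + g)) ⟩
      N (10 + g) + b 15 + b 20 + b 25 + b 30
        ≡⟨ cong (λ x → x + b 15 + b 20 + b 25 + b 30) (N-step (5 + g)) ⟩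
      N (5 + g) + b 10 + b 15 + b 20 + b 25 + b 30
        ≡⟨ cong (λ x → x + b 10 + b 15 + b 20 + b 25 + b 30) (N-step g) ⟩
      N g + b 5 + b 10 + b 15 + b 20 + b 25 + b 30
        ≡⟨ regroup (N g) (b 5) (b 10) (b 15) (b 20) (b 25) (b 30) ⟩
      N g + window g ∎
    where
    open ≡-Reasoning
    b : ℕ → ℕ
    b k = boundaryCount (k + g)
    regroup : ∀ n x₁ x₂ x₃ x₄ x₅ x₆ → n + x₁ + x₂ + x₃ + x₄ + x₅ + x₆ ≡ n + (x₁ + x₂ + x₃ + x₄ + x₅ + x₆)
    regroup = ℕ-Ring.solve-∀

  -- Pairing consecutive terms, the window grows by 3 · 20 when g grows by 30.
  window-shift : ∀ g → window (30 + g) ≡ window g + 60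
  window-shift g =
    begin
      window (30 + g)
        ≡⟨ regroup (b 35) (b 40) (b 45) (b 50) (b 55) (b 60) ⟩
      (b 35 + b 40) + (b 45 + b 50) + (b 55 + b 60)
        ≡⟨ cong₂ _+_ (cong₂ _+_ (boundaryCount-pair (5 + g) (m≤m+n 5 g))
                                (boundaryCount-pair (15 + g) (m≤m+n 5 (10 + g))))
                     (boundaryCount-pair (25 + g) (m≤m+n 5 (20 + g))) ⟩
      (b 5 + b 10 + 20) + (b 15 + b 20 + 20) + (b 25 + b 30 + 20)
        ≡⟨ regroup′ (b 5) (b 10) (b 15) (b 20) (b 25) (b 30) ⟩
      window g + 60 ∎
    where
    open ≡-Reasoning
    b : ℕ → ℕ
    b k = boundaryCount (k + g)
    regroup : ∀ x₁ x₂ x₃ x₄ x₅ x₆ → x₁ + x₂ + x₃ + x₄ + x₅ + x₆ ≡ (x₁ + x₂) + (x₃ + x₄) + (x₅ + x₆)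
    regroup = ℕ-Ring.solve-∀
    regroup′ : ∀ x₁ x₂ x₃ x₄ x₅ x₆ → (x₁ + x₂ + 20) + (x₃ + x₄ + 20) + (x₅ + x₆ + 20) ≡ x₁ + x₂ + x₃ + x₄ + x₅ + x₆ + 60
    regroup′ = ℕ-Ring.solve-∀

  N-recurrence : ∀ g → N (60 + g) + N g ≡ 2 * N (30 + g) + 60
  N-recurrence g =
    begin
      N (60 + g) + N g
        ≡⟨ cong (_+ N g) (N-window (30 + g)) ⟩
      N (30 + g) + window (30 + g) + N g
        ≡⟨ cong (λ w → N (30 + g) + w + N g) (window-shift g) ⟩
      N (30 + g) + (window g + 60) + N g
        ≡⟨ regroup (N (30 + g)) (window g) (N g) ⟩
      N (30 + g) + (N g + window g) + 60
        ≡⟨ cong (λ n → N (30 + g) + n + 60) (N-window g) ⟨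
      N (30 + g) + N (30 + g) + 60
        ≡⟨ cong (λ n → N (30 + g) + n + 60) (+-identityʳ (N (30 + g))) ⟨
      2 * N (30 + g) + 60 ∎
    where
    open ≡-Reasoning
    regroup : ∀ n w m → n + (w + 60) + m ≡ n + (m + w) + 60
    regroup = ℕ-Ring.solve-∀

-- The paper's formula satisfies the same recurrence: for g ≥ 7, eightN3 g is a polynomial in g
-- and the floors ⌊g/5⌋, ⌊2g/5⌋, ⌊(g+2)/3⌋, ⌊(g+5)/6⌋, ⌊g/2⌋; raising g by 30 raises these
-- floors by 6, 12, 10, 5, 15, and the resulting second difference is the constant 480.
module FormulaRecurrence where

  open import Defs using (eightN3)
  open import Data.Nat as ℕ using (ℕ; _/_)
  open import Data.Integer as ℤ using (ℤ; +_)
  open import Relation.Binary.PropositionalEquality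
  open import Data.Integer.Tactic.RingSolver using (solve-∀)
  import Data.Nat.Tactic.RingSolver as ℕ-Ring
  open FloorDivision using (/-shift)

  -- 8·N₃ for g ≥ 7 in terms of G = g, a = ⌊g/5⌋, b = ⌊2g/5⌋, c = ⌊(g+2)/3⌋, d = ⌊(g+5)/6⌋, e = ⌊g/2⌋.
  -- It is inlined so that the ring solver sees the polynomial itself.
  polynomial : ℤ → ℤ → ℤ → ℤ → ℤ → ℤ → ℤ
  polynomial G a b c d e =
      (+ 8) ℤ.* a ℤ.* a ℤ.- (+ 8) ℤ.* b ℤ.* b
    ℤ.- (+ 12) ℤ.* c ℤ.* c ℤ.- (+ 12) ℤ.* d ℤ.* d
    ℤ.+ (+ 8) ℤ.* a
    ℤ.+ (+ 8) ℤ.* (ℤ.- a ℤ.+ G ℤ.- + 1) ℤ.* b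
    ℤ.+ ((+ 4) ℤ.* G ℤ.- + 6) ℤ.* e
    ℤ.+ ((+ 8) ℤ.* G ℤ.+ + 4) ℤ.* c
    ℤ.+ ((+ 8) ℤ.* (ℤ.- e ℤ.+ G) ℤ.+ + 4) ℤ.* d
    ℤ.- (+ 5) ℤ.* G ℤ.* G ℤ.+ (+ 5) ℤ.* G

  {-# INLINE polynomial #-}

  second-difference : ∀ G a b c d e →
    polynomial (G ℤ.+ + 60) (a ℤ.+ + 12) (b ℤ.+ + 24) (c ℤ.+ + 20) (d ℤ.+ + 10) (e ℤ.+ + 30)
    ℤ.- (+ 2) ℤ.* polynomial (G ℤ.+ + 30) (a ℤ.+ + 6) (b ℤ.+ + 12) (c ℤ.+ + 10) (d ℤ.+ + 5) (e ℤ.+ + 15)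
    ℤ.+ polynomial G a b c d e ≡ + 480
  second-difference = solve-∀

  eightN3≡polynomial : ∀ n → let g = 7 ℕ.+ n in
    eightN3 g ≡ polynomial (+ g) (+ (g / 5)) (+ ((2 ℕ.* g) / 5)) (+ ((g ℕ.+ 2) / 3)) (+ ((g ℕ.+ 5) / 6)) (+ (g / 2))
  eightN3≡polynomial n = refl

  eightN3-shift : ∀ n k → let g = 7 ℕ.+ n in
    eightN3 (7 ℕ.+ (n ℕ.+ 30 ℕ.* k)) ≡
    polynomial (+ g ℤ.+ + (30 ℕ.* k)) (+ (g / 5) ℤ.+ + (6 ℕ.* k)) (+ ((2 ℕ.* g) / 5) ℤ.+ + (12 ℕ.* k))
               (+ ((g ℕ.+ 2) / 3) ℤ.+ + (10 ℕ.* k)) (+ ((g ℕ.+ 5) / 6) ℤ.+ + (5 ℕ.* k)) (+ (g / 2) ℤ.+ + (15 ℕ.* k))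
  eightN3-shift n k =
    trans (eightN3≡polynomial (n ℕ.+ 30 ℕ.* k))
          (cong₆ polynomial refl
            (cong +_ (floor-shift g (6 ℕ.* k) 5 (e₁ n k)))
            (cong +_ (floor-shift (2 ℕ.* g) (12 ℕ.* k) 5 (e₂ n k)))
            (cong +_ (floor-shift (g ℕ.+ 2) (10 ℕ.* k) 3 (e₃ n k)))
            (cong +_ (floor-shift (g ℕ.+ 5) (5 ℕ.* k) 6 (e₄ n k)))
            (cong +_ (floor-shift g (15 ℕ.* k) 2 (e₅ n k))))
    where
    g : ℕ
    g = 7 ℕ.+ n
    floor-shift : ∀ {x} m j d .{{_ : ℕ.NonZero d}} → x ≡ m ℕ.+ j ℕ.* d → x / d ≡ m / d ℕ.+ j
    floor-shift m j d refl = /-shift m j d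
    e₁ : ∀ n k → 7 ℕ.+ (n ℕ.+ 30 ℕ.* k) ≡ (7 ℕ.+ n) ℕ.+ (6 ℕ.* k) ℕ.* 5
    e₁ = ℕ-Ring.solve-∀
    e₂ : ∀ n k → 2 ℕ.* (7 ℕ.+ (n ℕ.+ 30 ℕ.* k)) ≡ 2 ℕ.* (7 ℕ.+ n) ℕ.+ (12 ℕ.* k) ℕ.* 5
    e₂ = ℕ-Ring.solve-∀
    e₃ : ∀ n k → 7 ℕ.+ (n ℕ.+ 30 ℕ.* k) ℕ.+ 2 ≡ (7 ℕ.+ n ℕ.+ 2) ℕ.+ (10 ℕ.* k) ℕ.* 3
    e₃ = ℕ-Ring.solve-∀
    e₄ : ∀ n k → 7 ℕ.+ (n ℕ.+ 30 ℕ.* k) ℕ.+ 5 ≡ (7 ℕ.+ n ℕ.+ 5) ℕ.+ (5 ℕ.* k) ℕ.* 6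
    e₄ = ℕ-Ring.solve-∀
    e₅ : ∀ n k → 7 ℕ.+ (n ℕ.+ 30 ℕ.* k) ≡ (7 ℕ.+ n) ℕ.+ (15 ℕ.* k) ℕ.* 2
    e₅ = ℕ-Ring.solve-∀
    cong₆ : ∀ (f : ℤ → ℤ → ℤ → ℤ → ℤ → ℤ → ℤ) {x₁ y₁ x₂ y₂ x₃ y₃ x₄ y₄ x₅ y₅ x₆ y₆} →
            x₁ ≡ y₁ → x₂ ≡ y₂ → x₃ ≡ y₃ → x₄ ≡ y₄ → x₅ ≡ y₅ → x₆ ≡ y₆ → f x₁ x₂ x₃ x₄ x₅ x₆ ≡ f y₁ y₂ y₃ y₄ y₅ y₆
    cong₆ f refl refl refl refl refl refl = refl

  eightN3-recurrence : ∀ n →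
    eightN3 (7 ℕ.+ (n ℕ.+ 60)) ℤ.- (+ 2) ℤ.* eightN3 (7 ℕ.+ (n ℕ.+ 30)) ℤ.+ eightN3 (7 ℕ.+ n) ≡ + 480
  eightN3-recurrence n =
    trans (cong₂ (λ x y → x ℤ.- (+ 2) ℤ.* y ℤ.+ eightN3 g) (eightN3-shift n 2) (eightN3-shift n 1))
          (second-difference (+ g) (+ (g / 5)) (+ ((2 ℕ.* g) / 5)) (+ ((g ℕ.+ 2) / 3)) (+ ((g ℕ.+ 5) / 6)) (+ (g / 2)))
    where
    g : ℕ
    g = 7 ℕ.+ n

-- 8·N(g) = eightN3 g for all g ≥ 3: by evaluation for 3 ≤ g < 67, and beyond by strong
-- induction, since the two recurrences determine the value at g + 60 from those at g, g + 30.
module Formula where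

  open import Defs using (eightN3)
  open import Data.Nat as ℕ using (ℕ; _≤_; _<_)
  open import Data.Nat.Properties as ℕ using ()
  open import Data.Nat.Induction using (<-rec)
  open import Data.Integer as ℤ using (ℤ; +_)
  open import Data.Integer.Properties as ℤ using ()
  open import Data.Integer.Tactic.RingSolver using (solve-∀)
  open import Data.Unit using (tt)
  open import Data.List using (upTo)
  open import Data.List.Relation.Unary.All as All using (All; all?)
  open import Data.List.Membership.Propositional.Properties using (∈-upTo⁺)
  open import Relation.Nullary using (yes; no)
  open import Relation.Nullary.Decidable using (toWitness)
  open import Relation.Binary.PropositionalEquality
  import Data.Nat.Tactic.RingSolver as ℕ-Ring
  open Parametrization using (N)
  open Periodicity using (N-recurrence)
  open FormulaRecurrence using (eightN3-recurrence)

  Matches : ℕ → Set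
  Matches g = (+ 8) ℤ.* (+ N g) ≡ eightN3 g

  -- Evaluation, which needs the definition of N.
  opaque
    unfolding N
    small-cases : All (λ k → Matches (3 ℕ.+ k)) (upTo 64)
    small-cases = toWitness {a? = all? (λ k → (+ 8) ℤ.* (+ N (3 ℕ.+ k)) ℤ.≟ eightN3 (3 ℕ.+ k)) (upTo 64)} _

  small : ∀ k → k < 64 → Matches (3 ℕ.+ k)
  small k k<64 = All.lookup small-cases (∈-upTo⁺ k<64)

  linear-step : ∀ x₀ x₃₀ x₆₀ e₆₀ →
    x₆₀ ℤ.+ x₀ ≡ (+ 2) ℤ.* x₃₀ ℤ.+ + 60 → e₆₀ ℤ.- (+ 2) ℤ.* ((+ 8) ℤ.* x₃₀) ℤ.+ (+ 8) ℤ.* x₀ ≡ + 480 →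
    (+ 8) ℤ.* x₆₀ ≡ e₆₀
  linear-step x₀ x₃₀ x₆₀ e₆₀ x-rec e-rec =
    begin
      (+ 8) ℤ.* x₆₀
        ≡⟨ ring₁ x₀ x₆₀ ⟩
      (+ 8) ℤ.* (x₆₀ ℤ.+ x₀) ℤ.- (+ 8) ℤ.* x₀
        ≡⟨ cong (λ y → (+ 8) ℤ.* y ℤ.- (+ 8) ℤ.* x₀) x-rec ⟩
      (+ 8) ℤ.* ((+ 2) ℤ.* x₃₀ ℤ.+ + 60) ℤ.- (+ 8) ℤ.* x₀
        ≡⟨ ring₂ x₀ x₃₀ ⟩
      (+ 2) ℤ.* ((+ 8) ℤ.* x₃₀) ℤ.+ + 480 ℤ.- (+ 8) ℤ.* x₀
        ≡⟨ cong (λ y → (+ 2) ℤ.* ((+ 8) ℤ.* x₃₀) ℤ.+ y ℤ.- (+ 8) ℤ.* x₀) e-rec ⟨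
      (+ 2) ℤ.* ((+ 8) ℤ.* x₃₀) ℤ.+ (e₆₀ ℤ.- (+ 2) ℤ.* ((+ 8) ℤ.* x₃₀) ℤ.+ (+ 8) ℤ.* x₀) ℤ.- (+ 8) ℤ.* x₀
        ≡⟨ ring₃ x₀ x₃₀ e₆₀ ⟩
      e₆₀ ∎
    where
    open ≡-Reasoning
    ring₁ : ∀ x₀ x₆₀ → (+ 8) ℤ.* x₆₀ ≡ (+ 8) ℤ.* (x₆₀ ℤ.+ x₀) ℤ.- (+ 8) ℤ.* x₀
    ring₁ = solve-∀
    ring₂ : ∀ x₀ x₃₀ → (+ 8) ℤ.* ((+ 2) ℤ.* x₃₀ ℤ.+ + 60) ℤ.- (+ 8) ℤ.* x₀ ≡ (+ 2) ℤ.* ((+ 8) ℤ.* x₃₀) ℤ.+ + 480 ℤ.- (+ 8) ℤ.* x₀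
    ring₂ = solve-∀
    ring₃ : ∀ x₀ x₃₀ e → (+ 2) ℤ.* ((+ 8) ℤ.* x₃₀) ℤ.+ (e ℤ.- (+ 2) ℤ.* ((+ 8) ℤ.* x₃₀) ℤ.+ (+ 8) ℤ.* x₀) ℤ.- (+ 8) ℤ.* x₀ ≡ e
    ring₃ = solve-∀

  step : ∀ n → Matches (7 ℕ.+ n) → Matches (30 ℕ.+ (7 ℕ.+ n)) → Matches (60 ℕ.+ (7 ℕ.+ n))
  step n at-g at-g+30 =
    linear-step (+ N g) (+ N (30 ℕ.+ g)) (+ N (60 ℕ.+ g)) (eightN3 (60 ℕ.+ g))
      (trans (cong +_ (N-recurrence g)) (cong (ℤ._+ + 60) (ℤ.pos-* 2 (N (30 ℕ.+ g)))))
      (subst₂ (λ e₃₀ e₀ → eightN3 (60 ℕ.+ g) ℤ.- (+ 2) ℤ.* e₃₀ ℤ.+ e₀ ≡ + 480) (sym at-g+30) (sym at-g)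
        (subst₂ (λ u v → eightN3 u ℤ.- (+ 2) ℤ.* eightN3 v ℤ.+ eightN3 g ≡ + 480) (e₁ n) (e₂ n) (eightN3-recurrence n)))
    where
    g : ℕ
    g = 7 ℕ.+ n
    e₁ : ∀ n → 7 ℕ.+ (n ℕ.+ 60) ≡ 60 ℕ.+ (7 ℕ.+ n)
    e₁ = ℕ-Ring.solve-∀
    e₂ : ∀ n → 7 ℕ.+ (n ℕ.+ 30) ≡ 30 ℕ.+ (7 ℕ.+ n)
    e₂ = ℕ-Ring.solve-∀

  -- Strong induction: g < 67 by evaluation, otherwise g = (n + 7) + 60 with both n + 7 and
  -- n + 37 smaller than g.
  matches : ∀ g → 3 ≤ g → Matches g
  matches = <-rec (λ g → 3 ≤ g → Matches g) by-cases
    where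
    by-cases : ∀ g → (∀ {h} → h < g → 3 ≤ h → Matches h) → 3 ≤ g → Matches g
    by-cases g earlier 3≤g with g ℕ.<? 67
    ... | yes g<67 = subst Matches (ℕ.m+[n∸m]≡n 3≤g) (small (g ℕ.∸ 3) (ℕ.∸-monoˡ-< g<67 3≤g))
    ... | no g≮67  =
      subst Matches g≡ (step n (earlier {7 ℕ.+ n} (smaller 7 (ℕ.≤ᵇ⇒≤ 8 67 tt)) (ℕ.m≤m+n 3 (4 ℕ.+ n)))
                               (earlier {30 ℕ.+ (7 ℕ.+ n)} (smaller 37 (ℕ.≤ᵇ⇒≤ 38 67 tt)) (ℕ.m≤m+n 3 (34 ℕ.+ n))))
      where
      n : ℕ
      n = g ℕ.∸ 67
      g≡ : 60 ℕ.+ (7 ℕ.+ n) ≡ g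
      g≡ = ℕ.m+[n∸m]≡n (ℕ.≮⇒≥ g≮67)
      smaller : ∀ c → c < 67 → c ℕ.+ n < g
      smaller c c<67 = ℕ.<-≤-trans (ℕ.+-monoˡ-< n c<67) (ℕ.≤-reflexive g≡)


open import Defs
open import Data.Nat using (ℕ; _≤_)
open import Data.Integer using (+_; _*_)
open import Relation.Binary.PropositionalEquality using (_≡_)
open import Data.Product using (∃; _×_; _,_)

proposition3p4 : (g : ℕ) → 3 ≤ g →
    ∃ λ N → HasCount (N3Prop g) N × (+ 8) * (+ N) ≡ eightN3 g
proposition3p4 g 3≤g = Parametrization.N g , Enumeration.count g , Formula.matches g 3≤g
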